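{- There exists a Borel reduction from $E_0$ to the isomorphism relation on countable vertex-transitive tournaments. That is, there is a Borel function $f$ from $2^\omega$ into the space of binary relations on $\mathbb{N}$ such that each $f(x)$ is a vertex-transitive tournament and $x\mathrel{E_0}y$ if and only if $f(x)\cong f(y)$.
   Context: $E_0$ is the equivalence relation on $2^\omega$ given by $x\mathrel{E_0}y$ iff $x(n)=y(n)$ for all but finitely many $n$. A tournament is a directed graph in which for every pair of distinct vertices $x,y$ exactly one of $x\to y$, $y\to x$ holds (and there are no loops). It is vertex-transitive if its automorphism group acts transitively on its vertices. -}

module Defs where

open import Data.Nat using (ℕ; _≤_)
open import Data.Bool using (Bool; true; false)
open import Data.Product using (Σ; _×_; _,_)
open import Data.Sum using (_⊎_)
open import Relation.Nullary using (¬_)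
open import Relation.Binary.PropositionalEquality using (_≡_; _≢_)
open import Function.Bundles using (_↔_; Inverse; _⇔_)

Cantor : Set
Cantor = ℕ → Bool

-- The space of binary relations on ℕ, i.e. 2^(ℕ×ℕ); R a b ≡ true means a → b.
BinRel : Set
BinRel = ℕ → ℕ → Bool

E₀ : Cantor → Cantor → Set
E₀ x y = Σ ℕ λ N → ∀ n → N ≤ n → x n ≡ y n

-- Codes for Borel subsets of 2^ω: the σ-algebra generated by the
-- subbasic clopen sets {x | x n = b}, closed under complement and countable union.
data BorelCode : Set where
  basic : ℕ → Bool → BorelCode
  compl : BorelCode → BorelCode
  union : (ℕ → BorelCode) → BorelCode

⟦_⟧ : BorelCode → Cantor → Set
⟦ basic n b ⟧ x = x n ≡ b
⟦ compl c ⟧ x = ¬ (⟦ c ⟧ x)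
⟦ union cs ⟧ x = Σ ℕ λ i → ⟦ cs i ⟧ x

IsBorelSet : (Cantor → Set) → Set
IsBorelSet S = Σ BorelCode λ c → ∀ x → S x ⇔ ⟦ c ⟧ x

-- A function 2^ω → 2^(ℕ×ℕ) is Borel iff the preimage of every subbasic
-- set {R | R a b = true} is Borel (these generate the Borel σ-algebra of 2^(ℕ×ℕ)).
IsBorelFun : (Cantor → BinRel) → Set
IsBorelFun f = ∀ a b → IsBorelSet (λ x → f x a b ≡ true)

IsTournament : BinRel → Set
IsTournament R =
  (∀ a → R a a ≡ false) ×
  (∀ a b → a ≢ b → (R a b ≡ true × R b a ≡ false) ⊎ (R a b ≡ false × R b a ≡ true))

_≅_ : BinRel → BinRel → Set
R ≅ S = Σ (ℕ ↔ ℕ) λ σ → ∀ a b → R a b ≡ S (Inverse.to σ a) (Inverse.to σ b)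

IsVertexTransitive : BinRel → Set
IsVertexTransitive R =
  ∀ a b → Σ (ℕ ↔ ℕ) λ σ →
    (∀ u v → R u v ≡ R (Inverse.to σ u) (Inverse.to σ v)) × (Inverse.to σ a ≡ b)

-- Vertices are finitely supported functions ℤ → ℤ/7, and a word w : ℤ → Bool yields a tournament:
-- two vertices are compared at the highest level L where they differ, inside one of two
-- non-isomorphic vertex-transitive circulant tournaments of order 7, chosen by the letter w L.
-- Digitwise translations act transitively by automorphisms, and shifting the levels is an
-- isomorphism onto the tournament of the shifted word.  Conversely both small tournaments are
-- prime, so the set generated by two vertices under adding distinguishers is determined by their
-- highest level of difference; an isomorphism therefore induces an order isomorphism of the levels,
-- i.e. a shift, and it preserves letters because only the {1,2,3}-circulant has two vertices with
-- two common out-neighbours.  Finally the letter of word x at m is the bit after the lowest zero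
-- of the 2-adic integer (x₀ 0 1 x₁ 0 1 …) + m, so the words of x and y are shifts of each other
-- exactly when x E₀ y.
module Submission where

open import Defs
open import Data.Nat as ℕ using (ℕ; zero; suc; _+_; _*_; _∸_; _≤_; _<_; z≤n; s≤s; _%_; _/_; _^_; NonZero; _≤ᵇ_)
import Data.Nat.Properties as ℕP
open import Data.Nat.DivMod using (m%n<n; m/n<m; m≡m%n+[m/n]*n; [m+kn]%n≡m%n; m%n%n≡m%n; +-distrib-/-∣ʳ; m<n⇒m/n≡0; m*n/n≡m; m<n⇒m%n≡m)
open import Data.Nat.Divisibility using (divides)
open import Data.Nat.Tactic.RingSolver using () renaming (solve-∀ to ℕ-solve)
open import Data.Integer as ℤ using (ℤ; +_; -[1+_]; 0ℤ; 1ℤ; ∣_∣; _%ℕ_; _/ℕ_; +<+; -≤+; -≤-)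
import Data.Integer.Properties as ℤP
open import Data.Integer.DivMod using (n%ℕd<d; a≡a%ℕn+[a/ℕn]*n)
open import Data.Integer.Tactic.RingSolver using (solve-∀)
open import Data.Bool using (Bool; true; false; T; not; _∨_; if_then_else_)
open import Data.Bool.Properties using (T?) renaming (_≟_ to _≟ᵇ_)
open import Data.List using (List; []; _∷_; applyUpTo)
open import Data.Product using (Σ; ∃; _×_; _,_; proj₁; proj₂)
open import Data.Sum using (_⊎_; inj₁; inj₂)
open import Data.Empty using (⊥; ⊥-elim)
open import Function.Bundles using (_↔_; Inverse; mk↔ₛ′; _⇔_; mk⇔; Equivalence)
open import Level using (Level)
open import Relation.Nullary using (Dec; yes; no; ¬_; ¬?)
open import Relation.Nullary.Decidable using (True; toWitness; map′; isYes; decidable-stable; _×-dec_; _⊎-dec_; _→-dec_)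
open import Relation.Unary using (Decidable)
open import Relation.Binary.Definitions using (tri<; tri≈; tri>)
open import Relation.Binary.PropositionalEquality

digit : ℕ → ℕ → ℕ
digit zero a = a % 7
digit (suc i) a = digit i (a / 7)

digit<7 : ∀ i a → digit i a < 7
digit<7 zero a = m%n<n a 7
digit<7 (suc i) a = digit<7 i (a / 7)

/7≤ : ∀ {n a} → a ≤ suc n → a / 7 ≤ n
/7≤ {n} {zero} _ = z≤n
/7≤ {n} {suc a} le = ℕP.≤-pred (ℕP.≤-trans (m/n<m (suc a) 7 (s≤s (s≤s z≤n))) le)

digit-≡0 : ∀ i a → a ≤ i → digit i a ≡ 0
digit-≡0 zero .zero z≤n = refl
digit-≡0 (suc i) a le = digit-≡0 i (a / 7) (/7≤ le)

digit-≢ : ∀ {a b} → a ≢ b → ∃ λ i → digit i a ≢ digit i b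
digit-≢ {a} {b} = go (a + b) (ℕP.m≤m+n a b) (ℕP.m≤n+m b a)
  where
  go : ∀ n {a b} → a ≤ n → b ≤ n → a ≢ b → ∃ λ i → digit i a ≢ digit i b
  go zero z≤n z≤n a≢b = ⊥-elim (a≢b refl)
  go (suc n) {a} {b} a≤ b≤ a≢b with a % 7 ℕ.≟ b % 7
  ... | no ne = 0 , ne
  ... | yes eq = let i , ne = go n (/7≤ a≤) (/7≤ b≤) quotients-differ in suc i , ne
    where
    quotients-differ : a / 7 ≢ b / 7
    quotients-differ eq′ = a≢b (begin
      a                   ≡⟨ m≡m%n+[m/n]*n a 7 ⟩
      a % 7 + a / 7 * 7   ≡⟨ cong₂ (λ r q → r + q * 7) eq eq′ ⟩
      b % 7 + b / 7 * 7   ≡⟨ m≡m%n+[m/n]*n b 7 ⟨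
      b                   ∎)
      where open ≡-Reasoning

undigits : (ℕ → ℕ) → ℕ → ℕ
undigits f zero = 0
undigits f (suc B) = f 0 % 7 + undigits (λ i → f (suc i)) B * 7

undigits-%7 : ∀ f B → undigits f (suc B) % 7 ≡ f 0 % 7
undigits-%7 f B = trans ([m+kn]%n≡m%n (f 0 % 7) (undigits (λ i → f (suc i)) B) 7) (m%n%n≡m%n (f 0) 7)

undigits-/7 : ∀ f B → undigits f (suc B) / 7 ≡ undigits (λ i → f (suc i)) B
undigits-/7 f B = begin
  (f 0 % 7 + k * 7) / 7    ≡⟨ +-distrib-/-∣ʳ (f 0 % 7) (divides k refl) ⟩
  f 0 % 7 / 7 + k * 7 / 7  ≡⟨ cong₂ _+_ (m<n⇒m/n≡0 (m%n<n (f 0) 7)) (m*n/n≡m k 7) ⟩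
  k                        ∎
  where
  open ≡-Reasoning
  k = undigits (λ i → f (suc i)) B

digit-undigits-< : ∀ i f B → i < B → digit i (undigits f B) ≡ f i % 7
digit-undigits-< zero f (suc B) _ = undigits-%7 f B
digit-undigits-< (suc i) f (suc B) (s≤s i<B) =
  trans (cong (digit i) (undigits-/7 f B)) (digit-undigits-< i (λ j → f (suc j)) B i<B)

digit-undigits-≥ : ∀ i f B → B ≤ i → digit i (undigits f B) ≡ 0
digit-undigits-≥ i f zero _ = digit-≡0 i 0 z≤n
digit-undigits-≥ (suc i) f (suc B) (s≤s B≤i) =
  trans (cong (digit i) (undigits-/7 f B)) (digit-undigits-≥ i (λ j → f (suc j)) B B≤i)

zigzag : ℤ → ℕ
zigzag (+ n) = n * 2
zigzag -[1+ n ] = suc (n * 2)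

unzigzag : ℕ → ℤ
unzigzag zero = + 0
unzigzag (suc zero) = -[1+ 0 ]
unzigzag (suc (suc i)) with unzigzag i
... | + n = + suc n
... | -[1+ n ] = -[1+ suc n ]

zigzag-unzigzag : ∀ i → zigzag (unzigzag i) ≡ i
zigzag-unzigzag zero = refl
zigzag-unzigzag (suc zero) = refl
zigzag-unzigzag (suc (suc i)) with unzigzag i | zigzag-unzigzag i
... | + n | refl = refl
... | -[1+ n ] | refl = refl

unzigzag-zigzag : ∀ l → unzigzag (zigzag l) ≡ l
unzigzag-zigzag (+ zero) = refl
unzigzag-zigzag (+ suc n) rewrite unzigzag-zigzag (+ n) = refl
unzigzag-zigzag -[1+ zero ] = refl
unzigzag-zigzag -[1+ suc n ] rewrite unzigzag-zigzag -[1+ n ] = refl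

-- A vertex a : ℕ stands for the finitely supported function ℤ → {0,…,6} whose
-- value at level l is the base-7 digit of a at position zigzag l.
digitAt : ℕ → ℤ → ℕ
digitAt a l = digit (zigzag l) a

digitAt<7 : ∀ a l → digitAt a l < 7
digitAt<7 a l = digit<7 (zigzag l) a

digitAt-≡0 : ∀ a l → a ≤ zigzag l → digitAt a l ≡ 0
digitAt-≡0 a l = digit-≡0 (zigzag l) a

digitAt-≢ : ∀ {a b} → a ≢ b → ∃ λ l → digitAt a l ≢ digitAt b l
digitAt-≢ a≢b with digit-≢ a≢b
... | i , ne = unzigzag i , subst (λ j → digit j _ ≢ digit j _) (sym (zigzag-unzigzag i)) ne

digitAt-ext : ∀ a b → (∀ l → digitAt a l ≡ digitAt b l) → a ≡ b
digitAt-ext a b same with a ℕ.≟ b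
... | yes eq = eq
... | no ne = let l , differ = digitAt-≢ ne in ⊥-elim (differ (same l))

fromDigits : (ℤ → ℕ) → ℕ → ℕ
fromDigits f B = undigits (λ i → f (unzigzag i)) B

digitAt-fromDigits : ∀ f B → (∀ l → B ≤ zigzag l → f l ≡ 0) → (∀ l → f l < 7) →
  ∀ l → digitAt (fromDigits f B) l ≡ f l
digitAt-fromDigits f B vanish f<7 l with zigzag l ℕ.<? B
... | yes lt = begin
  digit (zigzag l) (fromDigits f B) ≡⟨ digit-undigits-< (zigzag l) _ B lt ⟩
  f (unzigzag (zigzag l)) % 7       ≡⟨ cong (λ l′ → f l′ % 7) (unzigzag-zigzag l) ⟩
  f l % 7                           ≡⟨ m<n⇒m%n≡m (f<7 l) ⟩
  f l                               ∎
  where open ≡-Reasoning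
... | no nlt = trans (digit-undigits-≥ (zigzag l) _ B (ℕP.≮⇒≥ nlt)) (sym (vanish l (ℕP.≮⇒≥ nlt)))

record HighestDiff (a b : ℕ) (L : ℤ) : Set where
  constructor _,_
  field
    differs : digitAt a L ≢ digitAt b L
    agrees-above : ∀ l → L ℤ.< l → digitAt a l ≡ digitAt b l

open HighestDiff public

HighestDiff-sym : ∀ {a b L} → HighestDiff a b L → HighestDiff b a L
HighestDiff-sym (ne , above) = (λ eq → ne (sym eq)) , (λ l lt → sym (above l lt))

HighestDiff-unique : ∀ {a b L L′} → HighestDiff a b L → HighestDiff a b L′ → L ≡ L′
HighestDiff-unique {L = L} {L′} (ne , above) (ne′ , above′) with ℤP.<-cmp L L′
... | tri< lt _ _ = ⊥-elim (ne′ (above L′ lt))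
... | tri≈ _ eq _ = eq
... | tri> _ _ gt = ⊥-elim (ne (above′ L gt))

module _ {P : ℤ → Set} (P? : Decidable P) where

  Highest : ℤ → Set
  Highest L = P L × (∀ l → L ℤ.< l → ¬ P l)

  highest-below : ∀ n B → (∀ l → B ℤ.< l → ¬ P l) → (∃ λ l → B ℤ.- + n ℤ.≤ l × P l) → ∃ Highest
  highest-below n B above witness with P? B
  ... | yes pB = B , pB , above
  highest-below zero B above (l , B≤l , pl) | no ¬pB = ⊥-elim (above′ l B≤l pl)
    where
    above′ : ∀ l → B ℤ.+ + 0 ℤ.≤ l → ¬ P l
    above′ l B≤l with l ℤP.≟ B
    ... | yes refl = ¬pB
    ... | no l≢B = above l (ℤP.≤∧≢⇒< (subst (ℤ._≤ l) (ℤP.+-identityʳ B) B≤l) (λ eq → l≢B (sym eq)))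
  highest-below (suc n) B above (l , le , pl) | no ¬pB =
    highest-below n (B ℤ.- 1ℤ) above′ (l , subst (ℤ._≤ l) (shift B (+ n)) le , pl)
    where
    shift : ∀ B m → B ℤ.- (1ℤ ℤ.+ m) ≡ (B ℤ.- 1ℤ) ℤ.- m
    shift = solve-∀
    pred-suc : ∀ B → 1ℤ ℤ.+ (B ℤ.- 1ℤ) ≡ B
    pred-suc = solve-∀
    above′ : ∀ l → B ℤ.- 1ℤ ℤ.< l → ¬ P l
    above′ l lt with l ℤP.≟ B
    ... | yes refl = ¬pB
    ... | no l≢B = above l (ℤP.≤∧≢⇒< (subst (ℤ._≤ l) (pred-suc B) (ℤP.i<j⇒suc[i]≤j lt)) (λ eq → l≢B (sym eq)))

differ⇒zigzag< : ∀ a b l → digitAt a l ≢ digitAt b l → zigzag l < a + b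
differ⇒zigzag< a b l ne with zigzag l ℕ.<? a + b
... | yes lt = lt
... | no nlt = ⊥-elim (ne (trans (digitAt-≡0 a l (ℕP.≤-trans (ℕP.m≤m+n a b) (ℕP.≮⇒≥ nlt)))
                                (sym (digitAt-≡0 b l (ℕP.≤-trans (ℕP.m≤n+m b a) (ℕP.≮⇒≥ nlt))))))

-- Opaque so that type checking never unfolds the search; only its specification is used.
opaque
  highestDiff : ∀ {a b} → a ≢ b → ∃ (HighestDiff a b)
  highestDiff {a} {b} a≢b with digitAt-≢ a≢b
  ... | l₀ , ne₀ with highest-below (λ l → ¬? (digitAt a l ℕ.≟ digitAt b l)) (suc (K + K)) (+ K) above
                                    (l₀ , ℤP.≤-trans (ℤP.≤-reflexive (start K)) (lower-bound l₀ ne₀) , ne₀)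
    where
    K : ℕ
    K = a + b
    above : ∀ l → + K ℤ.< l → ¬ digitAt a l ≢ digitAt b l
    above (+ m) (+<+ K<m) ne = ℕP.<-asym K<m (ℕP.≤-<-trans (ℕP.m≤m*n m 2) (differ⇒zigzag< a b (+ m) ne))
    start : ∀ K → + K ℤ.- + suc (K + K) ≡ -[1+ K ]
    start K = lemma (+ K)
      where
      lemma : ∀ k → k ℤ.- (1ℤ ℤ.+ (k ℤ.+ k)) ≡ ℤ.- (1ℤ ℤ.+ k)
      lemma = solve-∀
    lower-bound : ∀ l → digitAt a l ≢ digitAt b l → -[1+ K ] ℤ.≤ l
    lower-bound (+ m) _ = -≤+
    lower-bound -[1+ m ] ne = -≤- (ℕP.≤-trans (ℕP.m≤m*n m 2) (ℕP.≤-trans (ℕP.n≤1+n _) (ℕP.<⇒≤ (differ⇒zigzag< a b -[1+ m ] ne))))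
  ... | L , ne , none = L , ne , λ l lt → decidable-stable (digitAt a l ℕ.≟ digitAt b l) (none l lt)

HighestDiff-maximal : ∀ {a b L l} → HighestDiff a b L → digitAt a l ≢ digitAt b l → l ℤ.≤ L
HighestDiff-maximal {L = L} {l} (_ , above) ne with l ℤP.≤? L
... | yes l≤L = l≤L
... | no l≰L = ⊥-elim (ne (above l (ℤP.≰⇒> l≰L)))

highestDiff-≥ : ∀ {a b l} → digitAt a l ≢ digitAt b l → ∃ λ L → HighestDiff a b L × l ℤ.≤ L
highestDiff-≥ ne with highestDiff (λ { refl → ne refl })
... | L , top = L , top , HighestDiff-maximal top ne

mapDigits : (ℤ → ℕ → ℕ) → ℕ → ℕ → ℕ
mapDigits F B z = fromDigits (λ l → F l (digitAt z l)) (z + B)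

digitAt-mapDigits : ∀ F B z → (∀ l → B ≤ zigzag l → F l 0 ≡ 0) → (∀ l → F l (digitAt z l) < 7) →
  ∀ l → digitAt (mapDigits F B z) l ≡ F l (digitAt z l)
digitAt-mapDigits F B z F0 F<7 = digitAt-fromDigits _ (z + B) vanish F<7
  where
  vanish : ∀ l → z + B ≤ zigzag l → F l (digitAt z l) ≡ 0
  vanish l le rewrite digitAt-≡0 z l (ℕP.≤-trans (ℕP.m≤m+n z B) le) = F0 l (ℕP.≤-trans (ℕP.m≤n+m B z) le)

setDigit : ℕ → ℤ → ℕ → ℕ
setDigit s L δ = mapDigits update (suc (zigzag L)) s
  module SetDigit where
  update : ℤ → ℕ → ℕ
  update l d with l ℤP.≟ L
  ... | yes _ = δ
  ... | no _ = d

module _ (s : ℕ) (L : ℤ) {δ : ℕ} (δ<7 : δ < 7) where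

  private
    digitAt-setDigit : ∀ l → digitAt (setDigit s L δ) l ≡ SetDigit.update s L δ l (digitAt s l)
    digitAt-setDigit = digitAt-mapDigits (SetDigit.update s L δ) (suc (zigzag L)) s vanish bounded
      where
      vanish : ∀ l → suc (zigzag L) ≤ zigzag l → SetDigit.update s L δ l 0 ≡ 0
      vanish l le with l ℤP.≟ L
      ... | yes refl = ⊥-elim (ℕP.<-irrefl refl le)
      ... | no _ = refl
      bounded : ∀ l → SetDigit.update s L δ l (digitAt s l) < 7
      bounded l with l ℤP.≟ L
      ... | yes _ = δ<7
      ... | no _ = digitAt<7 s l

  digitAt-setDigit-≡ : digitAt (setDigit s L δ) L ≡ δ
  digitAt-setDigit-≡ with digitAt-setDigit L
  ... | eq with L ℤP.≟ L
  ...   | yes _ = eq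
  ...   | no L≢L = ⊥-elim (L≢L refl)

  digitAt-setDigit-≢ : ∀ {l} → l ≢ L → digitAt (setDigit s L δ) l ≡ digitAt s l
  digitAt-setDigit-≢ {l} l≢L with digitAt-setDigit l
  ... | eq with l ℤP.≟ L
  ...   | yes l≡L = ⊥-elim (l≢L l≡L)
  ...   | no _ = eq

  digitAt-setDigit-> : ∀ {l} → L ℤ.< l → digitAt (setDigit s L δ) l ≡ digitAt s l
  digitAt-setDigit-> {l} L<l = digitAt-setDigit-≢ {l} (λ { refl → ℤP.<-irrefl refl L<l })

  HighestDiff-setDigit : δ ≢ digitAt s L → HighestDiff (setDigit s L δ) s L
  HighestDiff-setDigit δ≢ = (λ eq → δ≢ (trans (sym digitAt-setDigit-≡) eq)) , λ l → digitAt-setDigit->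

setDigit-digitAt : ∀ s L → setDigit s L (digitAt s L) ≡ s
setDigit-digitAt s L = digitAt-ext _ s same
  where
  same : ∀ l → digitAt (setDigit s L (digitAt s L)) l ≡ digitAt s l
  same l with l ℤP.≟ L
  ... | yes refl = digitAt-setDigit-≡ s L (digitAt<7 s L)
  ... | no l≢L = digitAt-setDigit-≢ s L (digitAt<7 s L) l≢L

HighestDiff-setDigit₂ : ∀ s L {δ δ′} → δ < 7 → δ′ < 7 → δ ≢ δ′ → HighestDiff (setDigit s L δ) (setDigit s L δ′) L
HighestDiff-setDigit₂ s L δ<7 δ′<7 δ≢δ′ =
  (λ eq → δ≢δ′ (trans (sym (digitAt-setDigit-≡ s L δ<7)) (trans eq (digitAt-setDigit-≡ s L δ′<7)))) ,
  λ l L<l → trans (digitAt-setDigit-> s L δ<7 L<l) (sym (digitAt-setDigit-> s L δ′<7 L<l))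

-- The two circulant tournaments of order 7

-- true: the circulant tournament on ℤ/7 with connection set {1,2,3};
-- false: the Paley tournament, whose connection set is the quadratic residues {1,2,4}.
connection : Bool → ℕ → Bool
connection _ 1 = true
connection _ 2 = true
connection true 3 = true
connection false 4 = true
connection _ _ = false

circulant : Bool → ℕ → ℕ → Bool
circulant b α β = connection b ((β + 7 ∸ α) % 7)

Digit : ℕ → Set
Digit δ = δ < 7

-- Finite facts about digits are proved by evaluating decision procedures.  allBool? is built with
-- map′ so that evaluation only computes the Boolean part of a decision, never its proof.
module _ {p : Level} where

  allBool? : {P : Bool → Set p} → (∀ b → Dec (P b)) → Dec (∀ b → P b)
  allBool? P? = map′ (λ (t , f) → λ { true → t ; false → f }) (λ all → all true , all false) (P? true ×-dec P? false)

  by-evaluation : {A : Set p} (d : Dec A) → {True d} → A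
  by-evaluation d {ok} = toWitness ok

  allDigits? : {P : ℕ → Set p} → (∀ α → Dec (P α)) → Dec (∀ {α} → Digit α → P α)
  allDigits? P? = ℕP.allUpTo? P? 7

  anyDigit? : {P : ℕ → Set p} → (∀ α → Dec (P α)) → Dec (∃ λ α → Digit α × P α)
  anyDigit? P? = ℕP.anyUpTo? P? 7

circulant-antisym : ∀ b {α β} → Digit α → Digit β → α ≢ β → circulant b α β ≢ circulant b β α
circulant-antisym b α<7 β<7 = by-evaluation (allBool? λ b → allDigits? λ α → allDigits? λ β →
  ¬? (α ℕ.≟ β) →-dec ¬? (circulant b α β ≟ᵇ circulant b β α)) b α<7 β<7

circulant-translate : ∀ b {c α β} → Digit c → Digit α → Digit β →
  circulant b ((α + c) % 7) ((β + c) % 7) ≡ circulant b α β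
circulant-translate b c<7 α<7 β<7 = by-evaluation (allBool? λ b → allDigits? λ c → allDigits? λ α → allDigits? λ β →
  circulant b ((α + c) % 7) ((β + c) % 7) ≟ᵇ circulant b α β) b c<7 α<7 β<7

Distinguishes : Bool → ℕ → ℕ → ℕ → Set
Distinguishes b γ α β = γ ≢ α × γ ≢ β × circulant b γ α ≢ circulant b γ β

distinguishes? : ∀ b γ α β → Dec (Distinguishes b γ α β)
distinguishes? b γ α β = ¬? (γ ℕ.≟ α) ×-dec ¬? (γ ℕ.≟ β) ×-dec ¬? (circulant b γ α ≟ᵇ circulant b γ β)

distinguisher : ∀ b {α β} → Digit α → Digit β → α ≢ β → ∃ λ γ → Digit γ × Distinguishes b γ α β
distinguisher b α<7 β<7 = by-evaluation (allBool? λ b → allDigits? λ α → allDigits? λ β →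
  ¬? (α ℕ.≟ β) →-dec anyDigit? λ γ → distinguishes? b γ α β) b α<7 β<7

neighbour : ∀ b v {α} → Digit α → ∃ λ γ → Digit γ × γ ≢ α × circulant b γ α ≡ v
neighbour b v α<7 = by-evaluation (allBool? λ b → allBool? λ v → allDigits? λ α →
  anyDigit? λ γ → ¬? (γ ℕ.≟ α) ×-dec (circulant b γ α ≟ᵇ v)) b v α<7

paley-no-two-common-out : ∀ {α β γ δ} → Digit α → Digit β → Digit γ → Digit δ → α ≢ β → γ ≢ δ →
  ¬ (circulant false α γ ≡ true × circulant false α δ ≡ true × circulant false β γ ≡ true × circulant false β δ ≡ true)
paley-no-two-common-out α<7 β<7 γ<7 δ<7 = by-evaluation (allDigits? λ α → allDigits? λ β → allDigits? λ γ → allDigits? λ δ →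
  ¬? (α ℕ.≟ β) →-dec ¬? (γ ℕ.≟ δ) →-dec
  ¬? ((circulant false α γ ≟ᵇ true) ×-dec (circulant false α δ ≟ᵇ true) ×-dec
      (circulant false β γ ≟ᵇ true) ×-dec (circulant false β δ ≟ᵇ true))) α<7 β<7 γ<7 δ<7

+-∸-mod7 : ∀ {d c} → Digit d → Digit c → ((d + c) % 7 + (7 ∸ c)) % 7 ≡ d
+-∸-mod7 d<7 c<7 = by-evaluation (allDigits? λ d → allDigits? λ c → ((d + c) % 7 + (7 ∸ c)) % 7 ℕ.≟ d) d<7 c<7

∸-+-mod7 : ∀ {d c} → Digit d → Digit c → ((d + (7 ∸ c)) % 7 + c) % 7 ≡ d
∸-+-mod7 d<7 c<7 = by-evaluation (allDigits? λ d → allDigits? λ c → ((d + (7 ∸ c)) % 7 + c) % 7 ℕ.≟ d) d<7 c<7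

+-difference-mod7 : ∀ {d e} → Digit d → Digit e → (d + (e + 7 ∸ d) % 7) % 7 ≡ e
+-difference-mod7 d<7 e<7 = by-evaluation (allDigits? λ d → allDigits? λ e → (d + (e + 7 ∸ d) % 7) % 7 ℕ.≟ e) d<7 e<7

+-mod7-cancelʳ : ∀ {d e c} → Digit d → Digit e → Digit c → (d + c) % 7 ≡ (e + c) % 7 → d ≡ e
+-mod7-cancelʳ {c = c} d<7 e<7 c<7 eq =
  trans (sym (+-∸-mod7 d<7 c<7)) (trans (cong (λ x → (x + (7 ∸ c)) % 7) eq) (+-∸-mod7 e<7 c<7))

-- Both circulant tournaments are prime: a set of digits that is closed under adding distinguishers
-- of its members and has two elements is everything.  Two closure steps from any pair suffice,
-- which is checked on closures computed as 7-bit lists.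

_∋_ : List Bool → ℕ → Bool
[] ∋ _ = false
(b ∷ _) ∋ zero = b
(_ ∷ bs) ∋ suc n = bs ∋ n

applyUpTo-∋ : ∀ (f : ℕ → Bool) {n i} → i < n → applyUpTo f n ∋ i ≡ f i
applyUpTo-∋ f {suc n} {zero} _ = refl
applyUpTo-∋ f {suc n} {suc i} (s≤s i<n) = applyUpTo-∋ (λ j → f (suc j)) i<n

Extends : Bool → List Bool → ℕ → Set
Extends b S γ = T (S ∋ γ) ⊎ ∃ λ α → Digit α × ∃ λ β → Digit β × T (S ∋ α) × T (S ∋ β) × Distinguishes b γ α β

extends? : ∀ b S γ → Dec (Extends b S γ)
extends? b S γ = T? (S ∋ γ) ⊎-dec (anyDigit? λ α → anyDigit? λ β →
  T? (S ∋ α) ×-dec T? (S ∋ β) ×-dec distinguishes? b γ α β)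

extend : Bool → List Bool → List Bool
extend b S = applyUpTo (λ γ → isYes (extends? b S γ)) 7

pair : ℕ → ℕ → List Bool
pair α β = applyUpTo (λ γ → isYes (γ ℕ.≟ α) ∨ isYes (γ ℕ.≟ β)) 7

extend²-pair-full : ∀ b {α β} → Digit α → Digit β → α ≢ β → ∀ {δ} → Digit δ → T (extend b (extend b (pair α β)) ∋ δ)
extend²-pair-full b α<7 β<7 = by-evaluation (allBool? λ b → allDigits? λ α → allDigits? λ β →
  ¬? (α ℕ.≟ β) →-dec allDigits? λ δ → T? (extend b (extend b (pair α β)) ∋ δ)) b α<7 β<7

module _ {ℓ : Level} (b : Bool) {P : ℕ → Set ℓ}
  (closed : ∀ {γ α β} → Digit γ → Digit α → Digit β → Distinguishes b γ α β → P α → P β → P γ) where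

  Within : List Bool → Set ℓ
  Within S = ∀ {γ} → Digit γ → T (S ∋ γ) → P γ

  extend-within : ∀ {S} → Within S → Within (extend b S)
  extend-within {S} within {γ} γ<7 γ∈ with toWitness {a? = extends? b S γ} (subst T (applyUpTo-∋ (λ γ → isYes (extends? b S γ)) γ<7) γ∈)
  ... | inj₁ γ∈S = within γ<7 γ∈S
  ... | inj₂ (α , α<7 , β , β<7 , α∈ , β∈ , dist) = closed γ<7 α<7 β<7 dist (within α<7 α∈) (within β<7 β∈)

  circulant-prime : ∀ {α β} → Digit α → Digit β → α ≢ β → P α → P β → ∀ {δ} → Digit δ → P δ
  circulant-prime {α} {β} α<7 β<7 α≢β pα pβ δ<7 =
    extend-within {extend b (pair α β)} (extend-within {pair α β} pair-within) δ<7 (extend²-pair-full b α<7 β<7 α≢β δ<7)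
    where
    pair-within : Within (pair α β)
    pair-within {γ} γ<7 γ∈ with γ ℕ.≟ α | γ ℕ.≟ β | subst T (applyUpTo-∋ (λ γ → isYes (γ ℕ.≟ α) ∨ isYes (γ ℕ.≟ β)) γ<7) γ∈
    ... | yes refl | _ | _ = pα
    ... | no _ | yes refl | _ = pβ

-- The tournament of a word

Word : Set
Word = ℤ → Bool

tournament : Word → BinRel
tournament w a b with a ℕ.≟ b
... | yes _ = false
... | no a≢b = let L = proj₁ (highestDiff a≢b) in circulant (w L) (digitAt a L) (digitAt b L)

tournament-irrefl : ∀ w a → tournament w a a ≡ false
tournament-irrefl w a with a ℕ.≟ a
... | yes _ = refl
... | no a≢a = ⊥-elim (a≢a refl)

tournament-at : ∀ w {a b L} → HighestDiff a b L → tournament w a b ≡ circulant (w L) (digitAt a L) (digitAt b L)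
tournament-at w {a} {b} top with a ℕ.≟ b
... | yes refl = ⊥-elim (differs top refl)
... | no a≢b = cong (λ L → circulant (w L) (digitAt a L) (digitAt b L)) (HighestDiff-unique (proj₂ (highestDiff a≢b)) top)

tournament-isTournament : ∀ w → IsTournament (tournament w)
tournament-isTournament w = tournament-irrefl w , one-way
  where
  one-way : ∀ a b → a ≢ b → (tournament w a b ≡ true × tournament w b a ≡ false) ⊎ (tournament w a b ≡ false × tournament w b a ≡ true)
  one-way a b a≢b with highestDiff a≢b
  ... | L , top rewrite tournament-at w top | tournament-at w (HighestDiff-sym top)
    with circulant-antisym (w L) (digitAt<7 a L) (digitAt<7 b L) (differs top)
  ... | antisym with circulant (w L) (digitAt a L) (digitAt b L) | circulant (w L) (digitAt b L) (digitAt a L)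
  ...   | true | true = ⊥-elim (antisym refl)
  ...   | true | false = inj₁ (refl , refl)
  ...   | false | true = inj₂ (refl , refl)
  ...   | false | false = ⊥-elim (antisym refl)

Homomorphism : Word → Word → (ℕ → ℕ) → Set
Homomorphism w w′ f = ∀ u v → tournament w u v ≡ tournament w′ (f u) (f v)

levelwise-homomorphism : ∀ {w w′} (f : ℕ → ℕ) (τ : ℤ → ℤ) →
  (∀ {u v L} → HighestDiff u v L → HighestDiff (f u) (f v) (τ L)) →
  (∀ {u v L} → HighestDiff u v L →
    circulant (w L) (digitAt u L) (digitAt v L) ≡ circulant (w′ (τ L)) (digitAt (f u) (τ L)) (digitAt (f v) (τ L))) →
  Homomorphism w w′ f
levelwise-homomorphism {w} {w′} f τ top-f arcs u v = by-cases (u ℕ.≟ v)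
  where
  by-cases : Dec (u ≡ v) → tournament w u v ≡ tournament w′ (f u) (f v)
  by-cases (yes refl) = trans (tournament-irrefl w u) (sym (tournament-irrefl w′ (f u)))
  by-cases (no u≢v) = let L , top = highestDiff u≢v in
    trans (tournament-at w top) (trans (arcs top) (sym (tournament-at w′ (top-f top))))

module Translation (c : ℤ → ℕ) (B : ℕ) (c<7 : ∀ l → c l < 7) (c-vanish : ∀ l → B ≤ zigzag l → c l ≡ 0) where

  translate untranslate : ℕ → ℕ
  translate = mapDigits (λ l d → (d + c l) % 7) B
  untranslate = mapDigits (λ l d → (d + (7 ∸ c l)) % 7) B

  digitAt-translate : ∀ z l → digitAt (translate z) l ≡ (digitAt z l + c l) % 7
  digitAt-translate z = digitAt-mapDigits (λ l d → (d + c l) % 7) B z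
    (λ l le → cong (λ x → x % 7) (c-vanish l le)) (λ l → m%n<n (digitAt z l + c l) 7)

  digitAt-untranslate : ∀ z l → digitAt (untranslate z) l ≡ (digitAt z l + (7 ∸ c l)) % 7
  digitAt-untranslate z = digitAt-mapDigits (λ l d → (d + (7 ∸ c l)) % 7) B z
    (λ l le → cong (λ x → (7 ∸ x) % 7) (c-vanish l le)) (λ l → m%n<n (digitAt z l + (7 ∸ c l)) 7)

  untranslate-translate : ∀ z → untranslate (translate z) ≡ z
  untranslate-translate z = digitAt-ext _ z λ l → begin
    digitAt (untranslate (translate z)) l          ≡⟨ digitAt-untranslate (translate z) l ⟩
    (digitAt (translate z) l + (7 ∸ c l)) % 7      ≡⟨ cong (λ x → (x + (7 ∸ c l)) % 7) (digitAt-translate z l) ⟩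
    ((digitAt z l + c l) % 7 + (7 ∸ c l)) % 7      ≡⟨ +-∸-mod7 (digitAt<7 z l) (c<7 l) ⟩
    digitAt z l                                    ∎
    where open ≡-Reasoning

  translate-untranslate : ∀ z → translate (untranslate z) ≡ z
  translate-untranslate z = digitAt-ext _ z λ l → begin
    digitAt (translate (untranslate z)) l          ≡⟨ digitAt-translate (untranslate z) l ⟩
    (digitAt (untranslate z) l + c l) % 7          ≡⟨ cong (λ x → (x + c l) % 7) (digitAt-untranslate z l) ⟩
    ((digitAt z l + (7 ∸ c l)) % 7 + c l) % 7      ≡⟨ ∸-+-mod7 (digitAt<7 z l) (c<7 l) ⟩
    digitAt z l                                    ∎
    where open ≡-Reasoning

  translation : ℕ ↔ ℕ
  translation = mk↔ₛ′ translate untranslate translate-untranslate untranslate-translate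

  translate-homomorphism : ∀ w → Homomorphism w w translate
  translate-homomorphism w = levelwise-homomorphism translate (λ L → L) top arcs
    where
    top : ∀ {u v L} → HighestDiff u v L → HighestDiff (translate u) (translate v) L
    top {u} {v} {L} (ne , above) =
      (λ eq → ne (+-mod7-cancelʳ (digitAt<7 u L) (digitAt<7 v L) (c<7 L)
                   (trans (sym (digitAt-translate u L)) (trans eq (digitAt-translate v L))))) ,
      λ l lt → trans (digitAt-translate u l) (trans (cong (λ x → (x + c l) % 7) (above l lt)) (sym (digitAt-translate v l)))
    arcs : ∀ {u v L} → HighestDiff u v L →
      circulant (w L) (digitAt u L) (digitAt v L) ≡ circulant (w L) (digitAt (translate u) L) (digitAt (translate v) L)
    arcs {u} {v} {L} _ = sym (trans (cong₂ (circulant (w L)) (digitAt-translate u L) (digitAt-translate v L))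
                                    (circulant-translate (w L) (c<7 L) (digitAt<7 u L) (digitAt<7 v L)))

tournament-vertexTransitive : ∀ w → IsVertexTransitive (tournament w)
tournament-vertexTransitive w a b = translation , translate-homomorphism w , a↦b
  where
  c : ℤ → ℕ
  c l = (digitAt b l + 7 ∸ digitAt a l) % 7
  c-vanish : ∀ l → a + b ≤ zigzag l → c l ≡ 0
  c-vanish l le rewrite digitAt-≡0 a l (ℕP.≤-trans (ℕP.m≤m+n a b) le) | digitAt-≡0 b l (ℕP.≤-trans (ℕP.m≤n+m b a) le) = refl
  open Translation c (a + b) (λ l → m%n<n (digitAt b l + 7 ∸ digitAt a l) 7) c-vanish
  a↦b : translate a ≡ b
  a↦b = digitAt-ext _ b λ l → trans (digitAt-translate a l) (+-difference-mod7 (digitAt<7 a l) (digitAt<7 b l))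

∣l∣≤zigzag : ∀ l → ∣ l ∣ ≤ zigzag l
∣l∣≤zigzag (+ n) = ℕP.m≤m*n n 2
∣l∣≤zigzag -[1+ n ] = s≤s (ℕP.m≤m*n n 2)

zigzag≤2∣l∣ : ∀ l → zigzag l ≤ ∣ l ∣ * 2
zigzag≤2∣l∣ (+ n) = ℕP.≤-refl
zigzag≤2∣l∣ -[1+ n ] = s≤s (ℕP.n≤1+n _)

∣i∣≤∣i+j∣+∣j∣ : ∀ i j → ∣ i ∣ ≤ ∣ i ℤ.+ j ∣ + ∣ j ∣
∣i∣≤∣i+j∣+∣j∣ i j = subst₂ (λ x y → ∣ x ∣ ≤ ∣ i ℤ.+ j ∣ + y) (cancel i j) (ℤP.∣-i∣≡∣i∣ j) (ℤP.∣i+j∣≤∣i∣+∣j∣ (i ℤ.+ j) (ℤ.- j))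
  where
  cancel : ∀ i j → (i ℤ.+ j) ℤ.- j ≡ i
  cancel = solve-∀

shiftBy : ℤ → ℕ → ℕ
shiftBy j a = fromDigits (λ l → digitAt a (l ℤ.+ j)) ((a + ∣ j ∣) * 2)

digitAt-shiftBy : ∀ j a l → digitAt (shiftBy j a) l ≡ digitAt a (l ℤ.+ j)
digitAt-shiftBy j a = digitAt-fromDigits _ ((a + ∣ j ∣) * 2) vanish (λ l → digitAt<7 a (l ℤ.+ j))
  where
  vanish : ∀ l → (a + ∣ j ∣) * 2 ≤ zigzag l → digitAt a (l ℤ.+ j) ≡ 0
  vanish l le = digitAt-≡0 a (l ℤ.+ j) (ℕP.≤-trans a≤ (∣l∣≤zigzag (l ℤ.+ j)))
    where
    a+∣j∣≤ : a + ∣ j ∣ ≤ ∣ l ∣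
    a+∣j∣≤ = ℕP.*-cancelʳ-≤ (a + ∣ j ∣) (∣ l ∣) 2 (ℕP.≤-trans le (zigzag≤2∣l∣ l))
    a≤ : a ≤ ∣ l ℤ.+ j ∣
    a≤ = ℕP.+-cancelʳ-≤ (∣ j ∣) a (∣ l ℤ.+ j ∣) (ℕP.≤-trans a+∣j∣≤ (∣i∣≤∣i+j∣+∣j∣ l j))

-+-cancel : ∀ l j → (l ℤ.- j) ℤ.+ j ≡ l
-+-cancel = solve-∀

shiftBy-inverse : ∀ j a → shiftBy (ℤ.- j) (shiftBy j a) ≡ a
shiftBy-inverse j a = digitAt-ext _ a λ l → begin
  digitAt (shiftBy (ℤ.- j) (shiftBy j a)) l  ≡⟨ digitAt-shiftBy (ℤ.- j) (shiftBy j a) l ⟩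
  digitAt (shiftBy j a) (l ℤ.- j)           ≡⟨ digitAt-shiftBy j a (l ℤ.- j) ⟩
  digitAt a ((l ℤ.- j) ℤ.+ j)               ≡⟨ cong (digitAt a) (-+-cancel l j) ⟩
  digitAt a l                               ∎
  where open ≡-Reasoning

shiftBy-inverse′ : ∀ j a → shiftBy j (shiftBy (ℤ.- j) a) ≡ a
shiftBy-inverse′ j a = subst (λ j′ → shiftBy j′ (shiftBy (ℤ.- j) a) ≡ a) (ℤP.neg-involutive j) (shiftBy-inverse (ℤ.- j) a)

digitAt-shiftBy-back : ∀ j a L → digitAt (shiftBy j a) (L ℤ.- j) ≡ digitAt a L
digitAt-shiftBy-back j a L = trans (digitAt-shiftBy j a (L ℤ.- j)) (cong (digitAt a) (-+-cancel L j))

HighestDiff-shiftBy : ∀ j {a b L} → HighestDiff a b L → HighestDiff (shiftBy j a) (shiftBy j b) (L ℤ.- j)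
HighestDiff-shiftBy j {a} {b} {L} (ne , above) =
  (λ eq → ne (trans (sym (digitAt-shiftBy-back j a L)) (trans eq (digitAt-shiftBy-back j b L)))) ,
  λ l lt → trans (digitAt-shiftBy j a l)
             (trans (above (l ℤ.+ j) (subst (ℤ._< l ℤ.+ j) (-+-cancel L j) (ℤP.+-monoˡ-< j lt)))
               (sym (digitAt-shiftBy j b l)))

shifted-isomorphic : ∀ w w′ j → (∀ L → w′ (L ℤ.- j) ≡ w L) → tournament w ≅ tournament w′
shifted-isomorphic w w′ j w′∘shift≡w =
  mk↔ₛ′ (shiftBy j) (shiftBy (ℤ.- j)) (shiftBy-inverse′ j) (shiftBy-inverse j) ,
  levelwise-homomorphism (shiftBy j) (ℤ._- j) (HighestDiff-shiftBy j) arcs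
  where
  arcs : ∀ {u v L} → HighestDiff u v L →
    circulant (w L) (digitAt u L) (digitAt v L) ≡
    circulant (w′ (L ℤ.- j)) (digitAt (shiftBy j u) (L ℤ.- j)) (digitAt (shiftBy j v) (L ℤ.- j))
  arcs {u} {v} {L} _ = sym (trans (cong (λ b → circulant b (digitAt (shiftBy j u) (L ℤ.- j)) (digitAt (shiftBy j v) (L ℤ.- j))) (w′∘shift≡w L))
                                  (cong₂ (circulant (w L)) (digitAt-shiftBy-back j u L) (digitAt-shiftBy-back j v L)))

-- Generated sets are spans

Closed : BinRel → (ℕ → Set) → Set
Closed R P = ∀ z s t → P s → P t → R z s ≢ R z t → P z

Generated : BinRel → ℕ → ℕ → ℕ → Set₁
Generated R a c b = ∀ P → Closed R P → P a → P c → P b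

Reaches : ℕ → ℕ → ℤ → Set
Reaches a c l = ∃ λ l′ → l ℤ.≤ l′ × digitAt c l′ ≢ digitAt a l′

Spanned : ℕ → ℕ → ℕ → Set
Spanned a c b = ∀ l → digitAt b l ≢ digitAt a l → Reaches a c l

reaches? : ∀ a c l → Dec (Reaches a c l)
reaches? a c l with c ℕ.≟ a
... | yes refl = no λ (_ , _ , ne) → ne refl
... | no c≢a with highestDiff c≢a
...   | L , top with l ℤP.≤? L
...     | yes l≤L = yes (L , l≤L , differs top)
...     | no l≰L = no λ (l′ , l≤l′ , ne) → ne (agrees-above top l′ (ℤP.<-≤-trans (ℤP.≰⇒> l≰L) l≤l′))

agrees-from : ∀ {a c x l} → ¬ Reaches a c l → Spanned a c x → ∀ l′ → l ℤ.≤ l′ → digitAt x l′ ≡ digitAt a l′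
agrees-from {a} {c} {x} ¬reach spanned l′ l≤l′ with digitAt x l′ ℕ.≟ digitAt a l′
... | yes eq = eq
... | no ne = let l″ , l′≤l″ , ne′ = spanned l′ ne in ⊥-elim (¬reach (l″ , ℤP.≤-trans l≤l′ l′≤l″ , ne′))

HighestDiff-agreeing : ∀ {z a x L l} → HighestDiff z a L → l ℤ.≤ L →
  (∀ l′ → l ℤ.≤ l′ → digitAt x l′ ≡ digitAt a l′) → HighestDiff z x L
HighestDiff-agreeing (ne , above) l≤L agree =
  (λ eq → ne (trans eq (agree _ l≤L))) ,
  λ l′ L<l′ → trans (above l′ L<l′) (sym (agree l′ (ℤP.≤-trans l≤L (ℤP.<⇒≤ L<l′))))

-- If z differs from a at a level l that c does not reach, then s and t agree with a from l on, so z
-- meets s and t at the same level L ≥ l with the same digits there.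
spanned-closed : ∀ w a c → Closed (tournament w) (Spanned a c)
spanned-closed w a c z s t s∈ t∈ distinguishes l ne with reaches? a c l
... | yes reach = reach
... | no ¬reach with highestDiff-≥ ne
...   | L , top , l≤L = ⊥-elim (distinguishes (begin
  tournament w z s                              ≡⟨ tournament-at w (HighestDiff-agreeing top l≤L s-agrees) ⟩
  circulant (w L) (digitAt z L) (digitAt s L)   ≡⟨ cong (circulant (w L) (digitAt z L)) (trans (s-agrees L l≤L) (sym (t-agrees L l≤L))) ⟩
  circulant (w L) (digitAt z L) (digitAt t L)   ≡⟨ tournament-at w (HighestDiff-agreeing top l≤L t-agrees) ⟨
  tournament w z t                              ∎))
  where
  open ≡-Reasoning
  s-agrees = agrees-from ¬reach s∈
  t-agrees = agrees-from ¬reach t∈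

generated⇒spanned : ∀ w {a c b} → Generated (tournament w) a c b → Spanned a c b
generated⇒spanned w {a} {c} gen = gen (Spanned a c) (spanned-closed w a c) (λ l ne → ⊥-elim (ne refl)) (λ l ne → l , ℤP.≤-refl , ne)

tournament-setDigit₂ : ∀ w s l {γ α} → γ < 7 → α < 7 → γ ≢ α →
  tournament w (setDigit s l γ) (setDigit s l α) ≡ circulant (w l) γ α
tournament-setDigit₂ w s l γ<7 α<7 γ≢α = trans (tournament-at w (HighestDiff-setDigit₂ s l γ<7 α<7 γ≢α))
  (cong₂ (circulant (w l)) (digitAt-setDigit-≡ s l γ<7) (digitAt-setDigit-≡ s l α<7))

tournament-setDigit : ∀ w s l {γ} → γ < 7 → γ ≢ digitAt s l → tournament w (setDigit s l γ) s ≡ circulant (w l) γ (digitAt s l)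
tournament-setDigit w s l γ<7 γ≢ = trans (cong (tournament w (setDigit s l _)) (sym (setDigit-digitAt s l)))
  (tournament-setDigit₂ w s l γ<7 (digitAt<7 s l) γ≢)

HighestDiff-setDigit-≤ : ∀ {s t l l′ γ} → γ < 7 → HighestDiff s t l → l′ ℤ.≤ l → γ ≢ digitAt t l′ →
  HighestDiff (setDigit s l′ γ) t l
HighestDiff-setDigit-≤ {s} {t} {l} {l′} {γ} γ<7 (ne , above) l′≤l γ≢ with l′ ℤP.≟ l
... | yes refl = (λ eq → γ≢ (trans (sym (digitAt-setDigit-≡ s l′ γ<7)) eq)) ,
                 λ l″ lt → trans (digitAt-setDigit-> s l′ γ<7 lt) (above l″ lt)
... | no l′≢l = (λ eq → ne (trans (sym (digitAt-setDigit-≢ s l′ γ<7 (λ e → l′≢l (sym e)))) eq)) ,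
                λ l″ lt → trans (digitAt-setDigit-> s l′ γ<7 (ℤP.≤-<-trans l′≤l lt)) (above l″ lt)

interpolate : ℕ → ℕ → ℕ → ℕ
interpolate a b i = fromDigits pick (a + b)
  module Interpolate where
  pick : ℤ → ℕ
  pick l with zigzag l ℕ.<? i
  ... | yes _ = digitAt b l
  ... | no _ = digitAt a l

module _ (a b : ℕ) where

  digitAt-interpolate : ∀ i l → digitAt (interpolate a b i) l ≡ Interpolate.pick a b i l
  digitAt-interpolate i = digitAt-fromDigits (Interpolate.pick a b i) (a + b) vanish bounded
    where
    vanish : ∀ l → a + b ≤ zigzag l → Interpolate.pick a b i l ≡ 0
    vanish l le with zigzag l ℕ.<? i
    ... | yes _ = digitAt-≡0 b l (ℕP.≤-trans (ℕP.m≤n+m b a) le)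
    ... | no _ = digitAt-≡0 a l (ℕP.≤-trans (ℕP.m≤m+n a b) le)
    bounded : ∀ l → Interpolate.pick a b i l < 7
    bounded l with zigzag l ℕ.<? i
    ... | yes _ = digitAt<7 b l
    ... | no _ = digitAt<7 a l

  interpolate-digits : ∀ i l → digitAt (interpolate a b i) l ≡ digitAt a l ⊎ digitAt (interpolate a b i) l ≡ digitAt b l
  interpolate-digits i l with zigzag l ℕ.<? i | digitAt-interpolate i l
  ... | yes _ | eq = inj₂ eq
  ... | no _ | eq = inj₁ eq

  interpolate-zero : interpolate a b 0 ≡ a
  interpolate-zero = digitAt-ext _ a λ l → trans (digitAt-interpolate 0 l) (pick l)
    where
    pick : ∀ l → Interpolate.pick a b 0 l ≡ digitAt a l
    pick l with zigzag l ℕ.<? 0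
    ... | no _ = refl

  interpolate-end : interpolate a b (a + b) ≡ b
  interpolate-end = digitAt-ext _ b λ l → trans (digitAt-interpolate (a + b) l) (pick l)
    where
    pick : ∀ l → Interpolate.pick a b (a + b) l ≡ digitAt b l
    pick l with zigzag l ℕ.<? a + b
    ... | yes _ = refl
    ... | no nlt = trans (digitAt-≡0 a l (ℕP.≤-trans (ℕP.m≤m+n a b) (ℕP.≮⇒≥ nlt)))
                         (sym (digitAt-≡0 b l (ℕP.≤-trans (ℕP.m≤n+m b a) (ℕP.≮⇒≥ nlt))))

  digitAt-interpolate-next : ∀ i → digitAt (interpolate a b i) (unzigzag i) ≡ digitAt a (unzigzag i)
  digitAt-interpolate-next i = trans (digitAt-interpolate i (unzigzag i)) pick
    where
    pick : Interpolate.pick a b i (unzigzag i) ≡ digitAt a (unzigzag i)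
    pick with zigzag (unzigzag i) ℕ.<? i
    ... | yes lt = ⊥-elim (ℕP.<-irrefl (zigzag-unzigzag i) lt)
    ... | no _ = refl

  interpolate-suc : ∀ i → interpolate a b (suc i) ≡ setDigit (interpolate a b i) (unzigzag i) (digitAt b (unzigzag i))
  interpolate-suc i = digitAt-ext _ _ same
    where
    λᵢ = unzigzag i
    same : ∀ l → digitAt (interpolate a b (suc i)) l ≡ digitAt (setDigit (interpolate a b i) λᵢ (digitAt b λᵢ)) l
    same l with l ℤP.≟ λᵢ
    ... | yes refl = trans (trans (digitAt-interpolate (suc i) λᵢ) pick) (sym (digitAt-setDigit-≡ (interpolate a b i) λᵢ (digitAt<7 b λᵢ)))
      where
      pick : Interpolate.pick a b (suc i) λᵢ ≡ digitAt b λᵢ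
      pick with zigzag λᵢ ℕ.<? suc i
      ... | yes _ = refl
      ... | no nlt = ⊥-elim (nlt (subst (ℕ._< suc i) (sym (zigzag-unzigzag i)) (ℕP.n<1+n i)))
    ... | no l≢λᵢ = trans (trans (digitAt-interpolate (suc i) l) pick) (trans (sym (digitAt-interpolate i l))
                      (sym (digitAt-setDigit-≢ (interpolate a b i) λᵢ (digitAt<7 b λᵢ) l≢λᵢ)))
      where
      zigzag≢i : zigzag l ≢ i
      zigzag≢i eq = l≢λᵢ (trans (sym (unzigzag-zigzag l)) (cong unzigzag eq))
      pick : Interpolate.pick a b (suc i) l ≡ Interpolate.pick a b i l
      pick with zigzag l ℕ.<? suc i | zigzag l ℕ.<? i
      ... | yes _ | yes _ = refl
      ... | no _ | no _ = refl
      ... | yes lt | no nlt = ⊥-elim (nlt (ℕP.≤∧≢⇒< (ℕP.≤-pred lt) zigzag≢i))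
      ... | no nlt | yes lt = ⊥-elim (nlt (ℕP.m≤n⇒m≤1+n lt))

module Generation (w : Word) (a c : ℕ) where

  G : ℕ → Set₁
  G = Generated (tournament w) a c

  G-closed : ∀ z s t → G s → G t → tournament w z s ≢ tournament w z t → G z
  G-closed z s t s∈ t∈ ne P closed a∈ c∈ = closed z s t (s∈ P closed a∈ c∈) (t∈ P closed a∈ c∈) ne

  a∈G : G a
  a∈G _ _ a∈ _ = a∈

  c∈G : G c
  c∈G _ _ _ c∈ = c∈

  -- Primality of the circulant tournament of type w l spreads G over all seven values of the
  -- l-th digit, starting from s and a distinguisher of s and t.
  fill : ∀ {s t l} → G s → G t → HighestDiff s t l → ∀ {δ} → δ < 7 → G (setDigit s l δ)
  fill {s} {t} {l} s∈ t∈ top@(ne , _) δ<7 =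
    circulant-prime (w l) {P = λ δ → G (setDigit s l δ)} closed (digitAt<7 s l) γ<7 (λ eq → γ≢s (sym eq))
      (subst G (sym (setDigit-digitAt s l)) s∈) z∈ δ<7
    where
    dist = distinguisher (w l) (digitAt<7 s l) (digitAt<7 t l) ne
    γ = proj₁ dist
    γ<7 = proj₁ (proj₂ dist)
    γ≢s = proj₁ (proj₂ (proj₂ dist))
    γ≢t = proj₁ (proj₂ (proj₂ (proj₂ dist)))
    z∈ : G (setDigit s l γ)
    z∈ = G-closed _ s t s∈ t∈ λ eq → proj₂ (proj₂ (proj₂ (proj₂ dist))) (begin
      circulant (w l) γ (digitAt s l)   ≡⟨ tournament-setDigit w s l γ<7 γ≢s ⟨
      tournament w (setDigit s l γ) s   ≡⟨ eq ⟩
      tournament w (setDigit s l γ) t   ≡⟨ tournament-at w (HighestDiff-setDigit-≤ γ<7 top ℤP.≤-refl γ≢t) ⟩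
      circulant (w l) (digitAt (setDigit s l γ) l) (digitAt t l) ≡⟨ cong (λ x → circulant (w l) x (digitAt t l)) (digitAt-setDigit-≡ s l γ<7) ⟩
      circulant (w l) γ (digitAt t l)   ∎)
      where open ≡-Reasoning
    closed : ∀ {γ α β} → Digit γ → Digit α → Digit β → Distinguishes (w l) γ α β →
      G (setDigit s l α) → G (setDigit s l β) → G (setDigit s l γ)
    closed γ<7 α<7 β<7 (γ≢α , γ≢β , differ) α∈ β∈ = G-closed _ _ _ α∈ β∈ λ eq →
      differ (trans (sym (tournament-setDigit₂ w s l γ<7 α<7 γ≢α)) (trans eq (tournament-setDigit₂ w s l γ<7 β<7 γ≢β)))

  -- Below the highest difference of s and t, a neighbour of s at level l′ that reverses the arc
  -- between s and t distinguishes them; fill then applies to it and s at level l′.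
  fill-below : ∀ {s t l l′} → G s → G t → HighestDiff s t l → l′ ℤ.< l → ∀ {δ} → δ < 7 → G (setDigit s l′ δ)
  fill-below {s} {t} {l} {l′} s∈ t∈ top l′<l =
    fill s∈ z∈ (HighestDiff-sym (HighestDiff-setDigit s l′ γ<7 γ≢s))
    where
    nb = neighbour (w l′) (not (tournament w s t)) (digitAt<7 s l′)
    γ = proj₁ nb
    γ<7 = proj₁ (proj₂ nb)
    γ≢s = proj₁ (proj₂ (proj₂ nb))
    z = setDigit s l′ γ
    z→s : tournament w z s ≡ not (tournament w s t)
    z→s = trans (tournament-setDigit w s l′ γ<7 γ≢s) (proj₂ (proj₂ (proj₂ nb)))
    z-top : HighestDiff z t l
    z-top = (λ eq → differs top (trans (sym (digitAt-setDigit-≢ s l′ γ<7 l≢l′)) eq)) ,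
            λ l″ lt → trans (digitAt-setDigit-> s l′ γ<7 (ℤP.<-trans l′<l lt)) (agrees-above top l″ lt)
      where
      l≢l′ : l ≢ l′
      l≢l′ eq = ℤP.<-irrefl (sym eq) l′<l
    z→t : tournament w z t ≡ tournament w s t
    z→t = trans (tournament-at w z-top) (trans (cong (λ x → circulant (w l) x (digitAt t l))
            (digitAt-setDigit-≢ s l′ γ<7 λ eq → ℤP.<-irrefl (sym eq) l′<l)) (sym (tournament-at w top)))
    not≢ : ∀ x → not x ≢ x
    not≢ true ()
    not≢ false ()
    z∈ : G z
    z∈ = G-closed z s t s∈ t∈ λ eq → not≢ (tournament w s t) (trans (sym z→s) (trans eq z→t))

  module FromTop {L : ℤ} (top : HighestDiff a c L) where

    -- s differs at L from a or from c, and fill or fill-below applies to that pair.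
    fill-agreeing : ∀ {s l} → G s → (∀ l′ → L ℤ.< l′ → digitAt s l′ ≡ digitAt a l′) → l ℤ.≤ L →
      ∀ {δ} → δ < 7 → G (setDigit s l δ)
    fill-agreeing {s} {l} s∈ agrees l≤L with partner | l ℤP.≟ L
      where
      partner : Σ ℕ λ t → G t × HighestDiff s t L
      partner with digitAt s L ℕ.≟ digitAt a L
      ... | yes eq = c , c∈G , (λ eq′ → differs top (trans (sym eq) eq′)) , λ l′ lt → trans (agrees l′ lt) (agrees-above top l′ lt)
      ... | no ne = a , a∈G , ne , agrees
    ... | t , t∈ , s-top | yes refl = fill s∈ t∈ s-top
    ... | t , t∈ , s-top | no l≢L = fill-below s∈ t∈ s-top (ℤP.≤∧≢⇒< l≤L l≢L)

    module _ {b} (b∈ : Spanned a c b) where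

      b-agrees : ∀ l → L ℤ.< l → digitAt b l ≡ digitAt a l
      b-agrees l L<l with digitAt b l ℕ.≟ digitAt a l
      ... | yes eq = eq
      ... | no ne = let l′ , l≤l′ , ne′ = b∈ l ne in ⊥-elim (ne′ (sym (agrees-above top l′ (ℤP.<-≤-trans L<l l≤l′))))

      interpolate-agrees : ∀ i l → L ℤ.< l → digitAt (interpolate a b i) l ≡ digitAt a l
      interpolate-agrees i l L<l with interpolate-digits a b i l
      ... | inj₁ eq = eq
      ... | inj₂ eq = trans eq (b-agrees l L<l)

      interpolate∈G : ∀ i → G (interpolate a b i)
      interpolate∈G zero = subst G (sym (interpolate-zero a b)) a∈G
      interpolate∈G (suc i) with digitAt b (unzigzag i) ℕ.≟ digitAt a (unzigzag i)
      ... | yes eq = subst G (sym (begin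
        interpolate a b (suc i)                                         ≡⟨ interpolate-suc a b i ⟩
        setDigit (interpolate a b i) (unzigzag i) (digitAt b (unzigzag i)) ≡⟨ cong (setDigit (interpolate a b i) (unzigzag i))
                                                                               (trans eq (sym (digitAt-interpolate-next a b i))) ⟩
        setDigit (interpolate a b i) (unzigzag i) (digitAt (interpolate a b i) (unzigzag i)) ≡⟨ setDigit-digitAt _ (unzigzag i) ⟩
        interpolate a b i                                               ∎)) (interpolate∈G i)
        where open ≡-Reasoning
      ... | no ne = subst G (sym (interpolate-suc a b i))
        (fill-agreeing (interpolate∈G i) (interpolate-agrees i) level≤L (digitAt<7 b (unzigzag i)))
        where
        level≤L : unzigzag i ℤ.≤ L
        level≤L with unzigzag i ℤP.≤? L
        ... | yes le = le
        ... | no nle = ⊥-elim (ne (b-agrees (unzigzag i) (ℤP.≰⇒> nle)))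

      b∈G : G b
      b∈G = subst G (interpolate-end a b) (interpolate∈G (a + b))

spanned⇒generated : ∀ w {a c b} → Spanned a c b → Generated (tournament w) a c b
spanned⇒generated w {a} {c} {b} b∈ with a ℕ.≟ c
... | no a≢c = let L , top = highestDiff a≢c in Generation.FromTop.b∈G w a c top b∈
... | yes refl = subst (Generation.G w a a) (digitAt-ext a b same) (Generation.a∈G w a a)
  where
  same : ∀ l → digitAt a l ≡ digitAt b l
  same l with digitAt b l ℕ.≟ digitAt a l
  ... | yes eq = sym eq
  ... | no ne = let _ , _ , ne′ = b∈ l ne in ⊥-elim (ne′ refl)

-- Isomorphisms are shifts

Generated-transport : ∀ {R S : BinRel} (f : ℕ → ℕ) → (∀ u v → R u v ≡ S (f u) (f v)) →
  ∀ {a c b} → Generated R a c b → Generated S (f a) (f c) (f b)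
Generated-transport {R} {S} f hom gen P closed = gen (λ z → P (f z)) closed′
  where
  closed′ : Closed R (λ z → P (f z))
  closed′ z s t s∈ t∈ ne = closed (f z) (f s) (f t) s∈ t∈ λ eq → ne (trans (hom z s) (trans eq (sym (hom z t))))

Spanned-transport : ∀ {w w′} (f : ℕ → ℕ) → Homomorphism w w′ f → ∀ {a c b} → Spanned a c b → Spanned (f a) (f c) (f b)
Spanned-transport {w} {w′} f hom b∈ = generated⇒spanned w′ (Generated-transport f hom (spanned⇒generated w b∈))

spanned⇒≤ : ∀ {a c b L L′} → HighestDiff a c L → HighestDiff a b L′ → Spanned a c b → L′ ℤ.≤ L
spanned⇒≤ top-c top-b b∈ with b∈ _ (λ eq → differs top-b (sym eq))
... | l′ , L′≤l′ , ne = ℤP.≤-trans L′≤l′ (HighestDiff-maximal top-c (λ eq → ne (sym eq)))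

spanned-below : ∀ {a c b L} → HighestDiff a c L → (∀ l → digitAt b l ≢ digitAt a l → l ℤ.≤ L) → Spanned a c b
spanned-below top below l ne = _ , below l ne , λ eq → differs top (sym eq)

≤⇒spanned : ∀ {a c b L L′} → HighestDiff a c L → HighestDiff a b L′ → L′ ℤ.≤ L → Spanned a c b
≤⇒spanned top-c top-b L′≤L = spanned-below top-c λ l ne → ℤP.≤-trans (HighestDiff-maximal top-b (λ eq → ne (sym eq))) L′≤L

HighestDiff-mutual : ∀ {o c L p q} → HighestDiff o c L → Spanned o c p → Spanned o c q →
  Spanned p q o → Spanned p q c → HighestDiff p q L
HighestDiff-mutual {o} {c} {L} {p} {q} top p∈ q∈ o∈ c∈ = differ-at-L , agree-above
  where
  agrees : ∀ {x} → Spanned o c x → ∀ l → L ℤ.< l → digitAt x l ≡ digitAt o l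
  agrees {x} x∈ l L<l with digitAt x l ℕ.≟ digitAt o l
  ... | yes eq = eq
  ... | no ne = let l′ , l≤l′ , ne′ = x∈ l ne in ⊥-elim (ne′ (sym (agrees-above top l′ (ℤP.<-≤-trans L<l l≤l′))))
  agree-above : ∀ l → L ℤ.< l → digitAt p l ≡ digitAt q l
  agree-above l L<l = trans (agrees p∈ l L<l) (sym (agrees q∈ l L<l))
  at-L : ∀ {l′} → L ℤ.≤ l′ → digitAt q l′ ≢ digitAt p l′ → digitAt p L ≢ digitAt q L
  at-L {l′} L≤l′ ne with l′ ℤP.≟ L
  ... | yes refl = λ eq → ne (sym eq)
  ... | no l′≢L = ⊥-elim (ne (sym (agree-above l′ (ℤP.≤∧≢⇒< L≤l′ (λ eq → l′≢L (sym eq))))))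
  differ-at-L : digitAt p L ≢ digitAt q L
  differ-at-L with digitAt p L ℕ.≟ digitAt o L
  ... | no ne = let _ , L≤l′ , ne′ = o∈ L (λ eq → ne (sym eq)) in at-L L≤l′ ne′
  ... | yes eq = let _ , L≤l′ , ne′ = c∈ L (λ eq′ → differs top (trans (sym eq) (sym eq′))) in at-L L≤l′ ne′

module _ {w w′ : Word} (f : ℕ → ℕ) (hom : Homomorphism w w′ f)
         {o c L M} (top : HighestDiff o c L) (top′ : HighestDiff (f o) (f c) M) where

  private
    q : ℕ → ℕ
    q δ = setDigit o L δ

    q-below : ∀ {δ} → δ < 7 → ∀ l → digitAt (q δ) l ≢ digitAt o l → l ℤ.≤ L
    q-below δ<7 l ne with l ℤP.≟ L
    ... | yes refl = ℤP.≤-refl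
    ... | no l≢L = ⊥-elim (ne (digitAt-setDigit-≢ o L δ<7 l≢L))

    c-below : ∀ {δ} → δ < 7 → ∀ l → digitAt c l ≢ digitAt (q δ) l → l ℤ.≤ L
    c-below δ<7 l ne with l ℤP.≤? L
    ... | yes l≤L = l≤L
    ... | no l≰L = ⊥-elim (ne (trans (sym (agrees-above top l (ℤP.≰⇒> l≰L))) (sym (digitAt-setDigit-> o L δ<7 (ℤP.≰⇒> l≰L)))))

    image-top : ∀ {i j} → i < 7 → j < 7 → i ≢ j → HighestDiff (f (q i)) (f (q j)) M
    image-top i<7 j<7 i≢j = HighestDiff-mutual top′
      (Spanned-transport f hom (spanned-below top (q-below i<7)))
      (Spanned-transport f hom (spanned-below top (q-below j<7)))
      (Spanned-transport f hom (spanned-below q-top λ l ne → q-below i<7 l (λ eq → ne (sym eq))))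
      (Spanned-transport f hom (spanned-below q-top (c-below i<7)))
      where
      q-top = HighestDiff-setDigit₂ o L i<7 j<7 i≢j

    image-arc : ∀ {i j} → i < 7 → j < 7 → i ≢ j → w L ≡ true → circulant true i j ≡ true →
      circulant (w′ M) (digitAt (f (q i)) M) (digitAt (f (q j)) M) ≡ true
    image-arc {i} {j} i<7 j<7 i≢j wL arc = begin
      circulant (w′ M) (digitAt (f (q i)) M) (digitAt (f (q j)) M) ≡⟨ tournament-at w′ (image-top i<7 j<7 i≢j) ⟨
      tournament w′ (f (q i)) (f (q j))                           ≡⟨ hom (q i) (q j) ⟨
      tournament w (q i) (q j)                                    ≡⟨ tournament-setDigit₂ w o L i<7 j<7 i≢j ⟩
      circulant (w L) i j                                         ≡⟨ cong (λ b → circulant b i j) wL ⟩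
      circulant true i j                                          ≡⟨ arc ⟩
      true                                                        ∎
      where open ≡-Reasoning

  -- In the {1,2,3}-circulant 0 and 1 both beat 2 and 3; the Paley tournament has no such configuration.
  type-preserved : w L ≡ true → w′ M ≡ true
  type-preserved wL with w′ M in eq
  ... | true = refl
  ... | false = ⊥-elim (paley-no-two-common-out (digit< 0) (digit< 1) (digit< 2) (digit< 3)
                  (differs (image-top 0<7 1<7 λ ())) (differs (image-top 2<7 3<7 λ ()))
                  (arc 0<7 2<7 (λ ()) refl , arc 0<7 3<7 (λ ()) refl , arc 1<7 2<7 (λ ()) refl , arc 1<7 3<7 (λ ()) refl))
    where
    0<7 : 0 < 7
    0<7 = s≤s z≤n
    1<7 : 1 < 7
    1<7 = s≤s (s≤s z≤n)
    2<7 : 2 < 7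
    2<7 = s≤s (s≤s (s≤s z≤n))
    3<7 : 3 < 7
    3<7 = s≤s (s≤s (s≤s (s≤s z≤n)))
    digit< : ∀ i → digitAt (f (q i)) M < 7
    digit< i = digitAt<7 (f (q i)) M
    arc : ∀ {i j} → i < 7 → j < 7 → i ≢ j → circulant true i j ≡ true →
      circulant false (digitAt (f (q i)) M) (digitAt (f (q j)) M) ≡ true
    arc {i} {j} i<7 j<7 i≢j arc-true = subst (λ b → circulant b (digitAt (f (q i)) M) (digitAt (f (q j)) M) ≡ true) eq (image-arc i<7 j<7 i≢j wL arc-true)

commutes-with-suc⇒shift : ∀ (F : ℤ → ℤ) → (∀ m → F (1ℤ ℤ.+ m) ≡ 1ℤ ℤ.+ F m) → ∀ m → F m ≡ m ℤ.+ F (+ 0)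
commutes-with-suc⇒shift F F-suc (+ zero) = sym (ℤP.+-identityˡ (F (+ 0)))
commutes-with-suc⇒shift F F-suc (+ suc n) =
  trans (F-suc (+ n)) (trans (cong (λ x → 1ℤ ℤ.+ x) (commutes-with-suc⇒shift F F-suc (+ n))) (sym (ℤP.+-assoc 1ℤ (+ n) (F (+ 0)))))
commutes-with-suc⇒shift F F-suc -[1+ n ] = negative n
  where
  predecessor : ∀ {x y} → x ≡ 1ℤ ℤ.+ y → y ≡ ℤ.-1ℤ ℤ.+ x
  predecessor {x} {y} refl = lemma y
    where
    lemma : ∀ y → y ≡ ℤ.-1ℤ ℤ.+ (1ℤ ℤ.+ y)
    lemma = solve-∀
  negative : ∀ n → F -[1+ n ] ≡ -[1+ n ] ℤ.+ F (+ 0)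
  negative zero = predecessor (F-suc -[1+ 0 ])
  negative (suc n) = trans (predecessor (F-suc -[1+ suc n ])) (trans (cong (λ x → ℤ.-1ℤ ℤ.+ x) (negative n))
    (sym (ℤP.+-assoc ℤ.-1ℤ -[1+ n ] (F (+ 0)))))

unit : ℤ → ℕ
unit m = setDigit 0 m 1

HighestDiff-unit : ∀ m → HighestDiff 0 (unit m) m
HighestDiff-unit m = HighestDiff-sym (HighestDiff-setDigit 0 m (s≤s (s≤s z≤n)) 1≢0)
  where
  1≢0 : 1 ≢ digitAt 0 m
  1≢0 eq with trans eq (digitAt-≡0 0 m z≤n)
  ... | ()

-- An isomorphism preserves spans, hence the order of the levels at which the units differ from 0;
-- the induced order isomorphism of ℤ is a shift, and type-preserved compares the letters.
module Isomorphism {w w′ : Word} (σ : ℕ ↔ ℕ) (hom : Homomorphism w w′ (Inverse.to σ)) where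

  private
    f g : ℕ → ℕ
    f = Inverse.to σ
    g = Inverse.from σ

    f∘g : ∀ y → f (g y) ≡ y
    f∘g = Inverse.strictlyInverseˡ σ

    g∘f : ∀ x → g (f x) ≡ x
    g∘f = Inverse.strictlyInverseʳ σ

    hom⁻¹ : Homomorphism w′ w g
    hom⁻¹ u v = trans (cong₂ (tournament w′) (sym (f∘g u)) (sym (f∘g v))) (sym (hom (g u) (g v)))

    spanned-reflect : ∀ {a c b} → Spanned (f a) (f c) (f b) → Spanned a c b
    spanned-reflect {a} {c} {b} b∈ =
      subst₂ (λ x y → Spanned x y b) (g∘f a) (g∘f c) (subst (Spanned _ _) (g∘f b) (Spanned-transport g hom⁻¹ b∈))

    f0≢ : ∀ m → f 0 ≢ f (unit m)
    f0≢ m eq = differs (HighestDiff-unit m) (cong (λ x → digitAt x m) (trans (sym (g∘f 0)) (trans (cong g eq) (g∘f (unit m)))))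

  Φ : ℤ → ℤ
  Φ m = proj₁ (highestDiff (f0≢ m))

  Φ-top : ∀ m → HighestDiff (f 0) (f (unit m)) (Φ m)
  Φ-top m = proj₂ (highestDiff (f0≢ m))

  Φ-mono : ∀ {m m′} → m ℤ.≤ m′ → Φ m ℤ.≤ Φ m′
  Φ-mono {m} {m′} le = spanned⇒≤ (Φ-top m′) (Φ-top m)
    (Spanned-transport f hom (≤⇒spanned (HighestDiff-unit m′) (HighestDiff-unit m) le))

  Φ-mono⁻¹ : ∀ {m m′} → Φ m ℤ.≤ Φ m′ → m ℤ.≤ m′
  Φ-mono⁻¹ {m} {m′} le = spanned⇒≤ (HighestDiff-unit m′) (HighestDiff-unit m)
    (spanned-reflect (≤⇒spanned (Φ-top m′) (Φ-top m) le))

  Φ-strict : ∀ {m m′} → m ℤ.< m′ → Φ m ℤ.< Φ m′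
  Φ-strict {m} {m′} lt = ℤP.≤∧≢⇒< (Φ-mono {m} {m′} (ℤP.<⇒≤ lt)) λ eq → ℤP.<⇒≱ lt (Φ-mono⁻¹ {m′} {m} (ℤP.≤-reflexive (sym eq)))

  -- The vertex c′ differs from f 0 exactly at L; its preimage c spans the same set as some unit.
  Φ-surjective : ∀ L → ∃ λ M → Φ M ≡ L
  Φ-surjective L = M , ℤP.≤-antisym (spanned⇒≤ c′-top (Φ-top M) unit∈) (spanned⇒≤ (Φ-top M) c′-top c′∈)
    where
    nb = neighbour true false (digitAt<7 (f 0) L)
    c′ = setDigit (f 0) L (proj₁ nb)
    c′-top : HighestDiff (f 0) c′ L
    c′-top = HighestDiff-sym (HighestDiff-setDigit (f 0) L (proj₁ (proj₂ nb)) (proj₁ (proj₂ (proj₂ nb))))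
    0≢gc′ : 0 ≢ g c′
    0≢gc′ eq = differs c′-top (cong (λ x → digitAt x L) (trans (cong f eq) (f∘g c′)))
    M = proj₁ (highestDiff 0≢gc′)
    gc′-top = proj₂ (highestDiff 0≢gc′)
    unit∈ : Spanned (f 0) c′ (f (unit M))
    unit∈ = subst (λ x → Spanned (f 0) x (f (unit M))) (f∘g c′)
      (Spanned-transport f hom (≤⇒spanned gc′-top (HighestDiff-unit M) ℤP.≤-refl))
    c′∈ : Spanned (f 0) (f (unit M)) c′
    c′∈ = subst (Spanned (f 0) (f (unit M))) (f∘g c′)
      (Spanned-transport f hom (≤⇒spanned (HighestDiff-unit M) gc′-top ℤP.≤-refl))

  Φ-suc : ∀ m → Φ (1ℤ ℤ.+ m) ≡ 1ℤ ℤ.+ Φ m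
  Φ-suc m = ℤP.≤-antisym upper lower
    where
    step : m ℤ.< 1ℤ ℤ.+ m
    step = ℤP.suc[i]≤j⇒i<j ℤP.≤-refl
    lower : 1ℤ ℤ.+ Φ m ℤ.≤ Φ (1ℤ ℤ.+ m)
    lower = ℤP.i<j⇒suc[i]≤j (Φ-strict {m} {1ℤ ℤ.+ m} step)
    M : ℤ
    M = proj₁ (Φ-surjective (1ℤ ℤ.+ Φ m))
    ΦM≡ : Φ M ≡ 1ℤ ℤ.+ Φ m
    ΦM≡ = proj₂ (Φ-surjective (1ℤ ℤ.+ Φ m))
    m<M : m ℤ.< M
    m<M = ℤP.≰⇒> λ M≤m → ℤP.<⇒≱ (ℤP.suc[i]≤j⇒i<j (ℤP.≤-reflexive (sym ΦM≡))) (Φ-mono {M} {m} M≤m)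
    upper : Φ (1ℤ ℤ.+ m) ℤ.≤ 1ℤ ℤ.+ Φ m
    upper = subst (Φ (1ℤ ℤ.+ m) ℤ.≤_) ΦM≡ (Φ-mono {1ℤ ℤ.+ m} {M} (ℤP.i<j⇒suc[i]≤j m<M))

  shift : ℤ
  shift = Φ (+ 0)

  letters : ∀ m → w m ≡ w′ (m ℤ.+ shift)
  letters m = trans (bool-ext (w m) (w′ (Φ m)) forward backward) (cong w′ (commutes-with-suc⇒shift Φ Φ-suc m))
    where
    forward : w m ≡ true → w′ (Φ m) ≡ true
    forward = type-preserved f hom (HighestDiff-unit m) (Φ-top m)
    backward : w′ (Φ m) ≡ true → w m ≡ true
    backward = type-preserved g hom⁻¹ (Φ-top m)
      (subst₂ (λ x y → HighestDiff x y m) (sym (g∘f 0)) (sym (g∘f (unit m))) (HighestDiff-unit m))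
    bool-ext : ∀ x y → (x ≡ true → y ≡ true) → (y ≡ true → x ≡ true) → x ≡ y
    bool-ext true y to _ = sym (to refl)
    bool-ext false true _ from = from refl
    bool-ext false false _ _ = refl

-- Adding integers to 2-adic integers

record Congruent (q : ℕ) (a b : ℤ) : Set where
  constructor _,_
  field
    quotient : ℤ
    equation : a ≡ b ℤ.+ quotient ℤ.* + q

Congruent-refl : ∀ q a → Congruent q a a
Congruent-refl q a = 0ℤ , algebra a (+ q)
  where
  algebra : ∀ a Q → a ≡ a ℤ.+ 0ℤ ℤ.* Q
  algebra = solve-∀

Congruent-sym : ∀ {q a b} → Congruent q a b → Congruent q b a
Congruent-sym {q} {a} {b} (t , e) = ℤ.- t , trans (algebra b t (+ q)) (cong (λ x → x ℤ.+ ℤ.- t ℤ.* + q) (sym e))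
  where
  algebra : ∀ b t Q → b ≡ (b ℤ.+ t ℤ.* Q) ℤ.+ ℤ.- t ℤ.* Q
  algebra = solve-∀

Congruent-trans : ∀ {q a b c} → Congruent q a b → Congruent q b c → Congruent q a c
Congruent-trans {q} {a} {b} {c} (t , e1) (s , e2) = s ℤ.+ t , trans e1 (trans (cong (λ x → x ℤ.+ t ℤ.* + q) e2) (algebra c s t (+ q)))
  where
  algebra : ∀ c s t Q → (c ℤ.+ s ℤ.* Q) ℤ.+ t ℤ.* Q ≡ c ℤ.+ (s ℤ.+ t) ℤ.* Q
  algebra = solve-∀

Congruent-+ : ∀ {q a b c d} → Congruent q a b → Congruent q c d → Congruent q (a ℤ.+ c) (b ℤ.+ d)
Congruent-+ {q} {a} {b} {c} {d} (t , e1) (s , e2) = t ℤ.+ s , trans (cong₂ ℤ._+_ e1 e2) (algebra b d t s (+ q))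
  where
  algebra : ∀ b d t s Q → (b ℤ.+ t ℤ.* Q) ℤ.+ (d ℤ.+ s ℤ.* Q) ≡ (b ℤ.+ d) ℤ.+ (t ℤ.+ s) ℤ.* Q
  algebra = solve-∀

%ℕ-congruent : ∀ a q .{{_ : NonZero q}} → Congruent q a (+ (a %ℕ q))
%ℕ-congruent a q = a /ℕ q , a≡a%ℕn+[a/ℕn]*n a q

pos-+-* : ∀ s m q → + s ℤ.+ + m ℤ.* + q ≡ + (s + m * q)
pos-+-* s m q = trans (cong (λ x → + s ℤ.+ x) (sym (ℤP.pos-* m q))) (sym (ℤP.pos-+ s (m * q)))

¬<-multiple : ∀ {q r} s n → r ≡ s + suc n * q → r < q → ⊥
¬<-multiple {q} {r} s n e rq = ℕP.<⇒≱ rq (subst (q ≤_) (sym e) (ℕP.≤-trans (ℕP.m≤n*m q (suc n)) (ℕP.m≤n+m (suc n * q) s)))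

Congruent-<⇒≡ : ∀ {q r s} → r < q → s < q → Congruent q (+ r) (+ s) → r ≡ s
Congruent-<⇒≡ {q} {r} {s} rq sq (+ zero , e) = ℤP.+-injective (trans e (algebra (+ s) (+ q)))
  where
  algebra : ∀ s Q → s ℤ.+ 0ℤ ℤ.* Q ≡ s
  algebra = solve-∀
Congruent-<⇒≡ {q} {r} {s} rq sq (+ suc n , e) = ⊥-elim (¬<-multiple s n (ℤP.+-injective (trans e (pos-+-* s (suc n) q))) rq)
Congruent-<⇒≡ {q} {r} {s} rq sq (-[1+ n ] , e) = ⊥-elim (¬<-multiple r n (ℤP.+-injective (trans e2 (pos-+-* r (suc n) q))) sq)
  where
  algebra₂ : ∀ s N Q → s ≡ (s ℤ.+ ℤ.- N ℤ.* Q) ℤ.+ N ℤ.* Q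
  algebra₂ = solve-∀
  e2 : + s ≡ + r ℤ.+ + (suc n) ℤ.* + q
  e2 = trans (algebra₂ (+ s) (+ suc n) (+ q)) (cong (λ x → x ℤ.+ + suc n ℤ.* + q) (sym e))

%ℕ-unique : ∀ a q .{{_ : NonZero q}} r → r < q → Congruent q a (+ r) → (a %ℕ q) ≡ r
%ℕ-unique a q r rq c = Congruent-<⇒≡ (n%ℕd<d a q) rq (Congruent-trans (Congruent-sym (%ℕ-congruent a q)) c)

%ℕ-cong : ∀ a b q .{{_ : NonZero q}} → Congruent q a b → (a %ℕ q) ≡ (b %ℕ q)
%ℕ-cong a b q c = %ℕ-unique a q (b %ℕ q) (n%ℕd<d b q) (Congruent-trans c (%ℕ-congruent b q))

%ℕ-small : ∀ v q .{{_ : NonZero q}} → v < q → + v %ℕ q ≡ v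
%ℕ-small v q lt = %ℕ-unique (+ v) q v lt (Congruent-refl q (+ v))

2^-nonZero : ∀ J → NonZero (2 ^ J)
2^-nonZero J = ℕP.m^n≢0 2 J

pow2 : ℕ → ℤ
pow2 n = + (2 ^ n)

pow2-+ : ∀ a b → pow2 (a + b) ≡ pow2 a ℤ.* pow2 b
pow2-+ a b = trans (cong +_ (ℕP.^-distribˡ-+-* 2 a b)) (ℤP.pos-* (2 ^ a) (2 ^ b))

pow2-suc : ∀ n → pow2 (suc n) ≡ + 2 ℤ.* pow2 n
pow2-suc n = ℤP.pos-* 2 (2 ^ n)

pos-∸1 : ∀ X → 1 ≤ X → + (X ∸ 1) ≡ + X ℤ.- 1ℤ
pos-∸1 (suc X) _ = algebra (+ X)
  where
  algebra : ∀ a → a ≡ (1ℤ ℤ.+ a) ℤ.- 1ℤ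
  algebra = solve-∀

∸1< : ∀ X → 1 ≤ X → X ∸ 1 < X
∸1< (suc X) _ = ℕP.n<1+n X

2^-split : ∀ J i → J ≤ i → 2 ^ i ≡ 2 ^ (i ∸ J) * 2 ^ J
2^-split J i le = trans (cong (2 ^_) (sym (ℕP.m∸n+n≡m le))) (ℕP.^-distribˡ-+-* 2 (i ∸ J) J)

n<2^n : ∀ n → n < 2 ^ n
n<2^n zero = s≤s z≤n
n<2^n (suc n) = ℕP.≤-trans (ℕP.+-mono-≤ (ℕP.m^n>0 2 n) (n<2^n n)) (ℕP.≤-reflexive (algebra (2 ^ n)))
  where
  algebra : ∀ P → P + P ≡ 2 * P
  algebra = ℕ-solve

2^≤2^suc∸1 : ∀ j → 2 ^ j ≤ 2 ^ suc j ∸ 1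
2^≤2^suc∸1 j = ℕP.≤-trans (ℕP.≤-reflexive (sym (ℕP.m+n∸n≡m (2 ^ j) 1)))
  (ℕP.∸-monoˡ-≤ 1 (ℕP.≤-trans (ℕP.+-monoʳ-≤ (2 ^ j) (ℕP.m^n>0 2 j)) (ℕP.≤-reflexive (algebra (2 ^ j)))))
  where
  algebra : ∀ P → P + P ≡ 2 * P
  algebra = ℕ-solve

≤ᵇ-true : ∀ {a c} → a ≤ c → (a ≤ᵇ c) ≡ true
≤ᵇ-true {a} {c} le with a ≤ᵇ c in eq
... | true = refl
... | false = ⊥-elim (subst T eq (ℕP.≤⇒≤ᵇ le))

≤ᵇ-false : ∀ {a c} → c < a → (a ≤ᵇ c) ≡ false
≤ᵇ-false {a} {c} lt with a ≤ᵇ c in eq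
... | false = refl
... | true = ⊥-elim (ℕP.<⇒≱ lt (ℕP.≤ᵇ⇒≤ a c (subst T (sym eq) _)))

bitValue : Bool → ℕ
bitValue true = 1
bitValue false = 0

bitValue≤1 : ∀ b → bitValue b ≤ 1
bitValue≤1 true = s≤s z≤n
bitValue≤1 false = z≤n

bitValue-onto : ∀ r → r < 2 → Σ Bool λ β → r ≡ bitValue β
bitValue-onto zero _ = false , refl
bitValue-onto (suc zero) _ = true , refl
bitValue-onto (suc (suc r)) (s≤s (s≤s ()))

bitValue-bound : ∀ v P b → v < P → v + bitValue b * P < 2 * P
bitValue-bound v P b lt = ℕP.<-≤-trans (ℕP.+-mono-<-≤ lt (ℕP.*-monoˡ-≤ P (bitValue≤1 b))) (ℕP.≤-reflexive (algebra P))
  where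
  algebra : ∀ P → P + 1 * P ≡ 2 * P
  algebra = ℕ-solve

bit-of-value : ∀ P v b → v < P → (P ≤ᵇ v + bitValue b * P) ≡ b
bit-of-value P v true _ = ≤ᵇ-true (ℕP.≤-trans (ℕP.m≤n+m P v) (ℕP.≤-reflexive (cong (λ u → v + u) (sym (ℕP.*-identityˡ P)))))
bit-of-value P v false lt = ≤ᵇ-false (subst (_< P) (sym (ℕP.+-identityʳ v)) lt)

parity : ∀ T → Σ ℕ λ r → r < 2 × Congruent 2 T (+ r)
parity T = (T %ℕ 2) , n%ℕd<d T 2 , %ℕ-congruent T 2

prefix : (ℕ → Bool) → ℕ → ℕ
prefix z zero = 0
prefix z (suc J) = prefix z J + bitValue (z J) * 2 ^ J

prefix<2^ : ∀ z J → prefix z J < 2 ^ J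
prefix<2^ z zero = s≤s z≤n
prefix<2^ z (suc J) = ℕP.≤-trans (ℕP.+-mono-<-≤ (prefix<2^ z J) (ℕP.*-monoˡ-≤ (2 ^ J) (bitValue≤1 (z J))))
  (ℕP.≤-reflexive (algebra (2 ^ J)))
  where
  algebra : ∀ P → P + 1 * P ≡ 2 * P
  algebra = ℕ-solve

prefix-split : ∀ z J d → Σ ℕ λ h → prefix z (J + d) ≡ prefix z J + h * 2 ^ J
prefix-split z J zero = 0 , trans (cong (prefix z) (ℕP.+-identityʳ J)) (sym (ℕP.+-identityʳ (prefix z J)))
prefix-split z J (suc d) with prefix-split z J d
... | h , e = h + bitValue (z (J + d)) * 2 ^ d , trans (cong (prefix z) (ℕP.+-suc J d))
   (trans (cong₂ _+_ e (cong (λ x → bitValue (z (J + d)) * x) (ℕP.^-distribˡ-+-* 2 J d))) (algebra (prefix z J) h (bitValue (z (J + d))) (2 ^ J) (2 ^ d)))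
  where
  algebra : ∀ a h b P Q → a + h * P + b * (P * Q) ≡ a + (h + b * Q) * P
  algebra = ℕ-solve

prefix-congruent : ∀ z J J' → J ≤ J' → Congruent (2 ^ J) (+ prefix z J') (+ prefix z J)
prefix-congruent z J J' le with prefix-split z J (J' ∸ J)
... | h , e = + h , trans (cong (λ x → + prefix z x) (sym (ℕP.m+[n∸m]≡n le))) (trans (cong +_ e) (trans (sym (ℤP.pos-+ (prefix z J) (h * 2 ^ J))) (cong (λ x → + prefix z J ℤ.+ x) (ℤP.pos-* h (2 ^ J)))))

prefix-bit : ∀ z i → (2 ^ i ≤ᵇ prefix z (suc i)) ≡ z i
prefix-bit z i = bit-of-value (2 ^ i) (prefix z i) (z i) (prefix<2^ z i)

prefix-cong : ∀ z z′ J → (∀ j → j < J → z j ≡ z′ j) → prefix z J ≡ prefix z′ J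
prefix-cong z z′ zero _ = refl
prefix-cong z z′ (suc J) same =
  cong₂ (λ a b → a + bitValue b * 2 ^ J) (prefix-cong z z′ J (λ j lt → same j (ℕP.m≤n⇒m≤1+n lt))) (same J (ℕP.n<1+n J))

-- The 2-adic integer z + m: its bit i is read off (z mod 2^(i+1)) + m modulo 2^(i+1).
sumMod : (ℕ → Bool) → ℤ → ℕ → ℕ
sumMod z m J = (+ prefix z J ℤ.+ m) %ℕ 2 ^ J
  where instance _ = 2^-nonZero J

sumBit : (ℕ → Bool) → ℤ → ℕ → Bool
sumBit z m i = 2 ^ i ≤ᵇ sumMod z m (suc i)

sumBit-cong : ∀ z z′ m i → (∀ j → j < suc i → z j ≡ z′ j) → sumBit z m i ≡ sumBit z′ m i
sumBit-cong z z′ m i same =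
  cong (λ r → 2 ^ i ≤ᵇ (+ r ℤ.+ m) %ℕ 2 ^ suc i) (prefix-cong z z′ (suc i) same)
  where instance _ = 2^-nonZero (suc i)

sumBit-from-congruence : ∀ Z s J i r → suc i ≤ J → r < 2 ^ suc i → Congruent (2 ^ suc i) (+ prefix Z J ℤ.+ s) (+ r) → sumBit Z s i ≡ (2 ^ i ≤ᵇ r)
sumBit-from-congruence Z s J i r le lt c = cong (2 ^ i ≤ᵇ_) (%ℕ-unique (+ prefix Z (suc i) ℤ.+ s) (2 ^ suc i) {{2^-nonZero (suc i)}} r lt
  (Congruent-trans (Congruent-+ (Congruent-sym (prefix-congruent Z (suc i) J le)) (Congruent-refl (2 ^ suc i) s)) c))

sumBit-ones : ∀ Z s J E (c : ℤ) → E ≤ J → + prefix Z J ℤ.+ s ≡ (pow2 E ℤ.- 1ℤ) ℤ.+ pow2 E ℤ.* c → ∀ j → j < E → sumBit Z s j ≡ true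
sumBit-ones Z s J E c EJ eV j jE = trans (sumBit-from-congruence Z s J j (2 ^ suc j ∸ 1) (ℕP.≤-trans jE EJ) (∸1< _ (ℕP.m^n>0 2 (suc j))) cg) (≤ᵇ-true (2^≤2^suc∸1 j))
  where
  d = E ∸ suc j
  eE : pow2 E ≡ pow2 (suc j) ℤ.* pow2 d
  eE = trans (cong pow2 (sym (ℕP.m+[n∸m]≡n jE))) (pow2-+ (suc j) d)
  cg : Congruent (2 ^ suc j) (+ prefix Z J ℤ.+ s) (+ (2 ^ suc j ∸ 1))
  cg = (pow2 d ℤ.- 1ℤ) ℤ.+ pow2 d ℤ.* c , trans eV (trans (cong (λ t → (t ℤ.- 1ℤ) ℤ.+ t ℤ.* c) eE)
      (trans (algebra (pow2 (suc j)) (pow2 d) c) (cong (λ t → t ℤ.+ ((pow2 d ℤ.- 1ℤ) ℤ.+ pow2 d ℤ.* c) ℤ.* pow2 (suc j)) (sym (pos-∸1 _ (ℕP.m^n>0 2 (suc j)))))))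
    where
    algebra : ∀ A B c → (A ℤ.* B ℤ.- 1ℤ) ℤ.+ (A ℤ.* B) ℤ.* c ≡ (A ℤ.- 1ℤ) ℤ.+ ((B ℤ.- 1ℤ) ℤ.+ B ℤ.* c) ℤ.* A
    algebra = solve-∀

sumBit-no-carry : ∀ z m J u → + prefix z J ℤ.+ m ≡ + u → u < 2 ^ J → ∀ i → J ≤ i → sumBit z m i ≡ z i
sumBit-no-carry z m J u eu ult i le = trans (cong (2 ^ i ≤ᵇ_) Rval) (bit-of-value (2 ^ i) v (z i) vlt)
  where
  SP = prefix-split z J (i ∸ J)
  h = proj₁ SP
  e1 : prefix z i ≡ prefix z J + h * 2 ^ J
  e1 = trans (cong (prefix z) (sym (ℕP.m+[n∸m]≡n le))) (proj₂ SP)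
  b = bitValue (z i)
  v = u + h * 2 ^ J
  hlt : h * 2 ^ J < 2 ^ (i ∸ J) * 2 ^ J
  hlt = subst (h * 2 ^ J <_) (2^-split J i le) (ℕP.≤-<-trans (ℕP.m≤n+m (h * 2 ^ J) (prefix z J)) (subst (_< 2 ^ i) e1 (prefix<2^ z i)))
  h< : suc h ≤ 2 ^ (i ∸ J)
  h< = ℕP.*-cancelʳ-< (2 ^ J) h (2 ^ (i ∸ J)) hlt
  vlt : v < 2 ^ i
  vlt = ℕP.<-≤-trans (ℕP.+-monoˡ-< (h * 2 ^ J) ult)
          (subst (2 ^ J + h * 2 ^ J ≤_) (sym (2^-split J i le)) (ℕP.*-monoˡ-≤ (2 ^ J) h<))
  eint : + prefix z (suc i) ℤ.+ m ≡ + (v + b * 2 ^ i)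
  eint = begin
      + (prefix z i + b * 2 ^ i) ℤ.+ m
    ≡⟨ cong (λ x → + (x + b * 2 ^ i) ℤ.+ m) e1 ⟩
      + (prefix z J + h * 2 ^ J + b * 2 ^ i) ℤ.+ m
    ≡⟨ cong (ℤ._+ m) (trans (ℤP.pos-+ (prefix z J + h * 2 ^ J) (b * 2 ^ i)) (cong (ℤ._+ + (b * 2 ^ i)) (ℤP.pos-+ (prefix z J) (h * 2 ^ J)))) ⟩
      ((+ prefix z J ℤ.+ + (h * 2 ^ J)) ℤ.+ + (b * 2 ^ i)) ℤ.+ m
    ≡⟨ algebra (+ prefix z J) (+ (h * 2 ^ J)) (+ (b * 2 ^ i)) m ⟩
      ((+ prefix z J ℤ.+ m) ℤ.+ + (h * 2 ^ J)) ℤ.+ + (b * 2 ^ i)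
    ≡⟨ cong (λ x → (x ℤ.+ + (h * 2 ^ J)) ℤ.+ + (b * 2 ^ i)) eu ⟩
      (+ u ℤ.+ + (h * 2 ^ J)) ℤ.+ + (b * 2 ^ i)
    ≡⟨ sym (trans (ℤP.pos-+ v (b * 2 ^ i)) (cong (ℤ._+ + (b * 2 ^ i)) (ℤP.pos-+ u (h * 2 ^ J)))) ⟩
      + (v + b * 2 ^ i) ∎
    where
    open ≡-Reasoning
    algebra : ∀ A H B M → ((A ℤ.+ H) ℤ.+ B) ℤ.+ M ≡ ((A ℤ.+ M) ℤ.+ H) ℤ.+ B
    algebra = solve-∀
  vb< : v + b * 2 ^ i < 2 ^ suc i
  vb< = ℕP.<-≤-trans (ℕP.+-mono-<-≤ vlt (ℕP.*-monoˡ-≤ (2 ^ i) (bitValue≤1 (z i)))) (ℕP.≤-reflexive (algebra (2 ^ i)))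
    where
    algebra : ∀ P → P + 1 * P ≡ 2 * P
    algebra = ℕ-solve
  Rval : sumMod z m (suc i) ≡ v + b * 2 ^ i
  Rval = trans (cong (λ x → (x %ℕ (2 ^ suc i)) {{2^-nonZero (suc i)}}) eint) (%ℕ-small (v + b * 2 ^ i) (2 ^ suc i) {{2^-nonZero (suc i)}} vb<)

true≢false : true ≢ false
true≢false ()

scan : (ℕ → Bool) → ℕ → ℕ → ℕ
scan b i zero = i
scan b i (suc f) = if b i then scan b (suc i) f else i

scan-≡ : ∀ b f i p → i ≤ p → p < i + f → (∀ j → i ≤ j → j < p → b j ≡ true) → b p ≡ false → scan b i f ≡ p
scan-≡ b zero i p le lt h bp = ⊥-elim (ℕP.<⇒≱ lt (subst (_≤ p) (sym (ℕP.+-identityʳ i)) le))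
scan-≡ b (suc f) i p le lt h bp with i ℕ.≟ p
... | yes refl rewrite bp = refl
... | no ne rewrite h i ℕP.≤-refl (ℕP.≤∧≢⇒< le ne) =
  scan-≡ b f (suc i) p (ℕP.≤∧≢⇒< le ne) (subst (p <_) (ℕP.+-suc i f) lt) (λ j le' lt' → h j (ℕP.≤-trans (ℕP.n≤1+n i) le') lt') bp

scan-least : ∀ (b : ℕ → Bool) (f i : ℕ) → ∀ j → i ≤ j → j < scan b i f → b j ≡ true
scan-least b zero i j le lt = ⊥-elim (ℕP.<⇒≱ lt le)
scan-least b (suc f) i j le lt with b i in eq
... | false = ⊥-elim (ℕP.<⇒≱ lt le)
... | true with i ℕ.≟ j
...   | yes refl = eq
...   | no ne = scan-least b f (suc i) j (ℕP.≤∧≢⇒< le ne) lt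

scan-false : ∀ (b : ℕ → Bool) (f i q : ℕ) → i ≤ q → q < i + f → b q ≡ false → b (scan b i f) ≡ false
scan-false b zero i q le lt bq = ⊥-elim (ℕP.<⇒≱ lt (subst (_≤ q) (sym (ℕP.+-identityʳ i)) le))
scan-false b (suc f) i q le lt bq with b i in eq
... | false = eq
... | true with i ℕ.≟ q
...   | yes refl = ⊥-elim (true≢false (trans (sym eq) bq))
...   | no ne = scan-false b f (suc i) q (ℕP.≤∧≢⇒< le ne) (subst (q <_) (ℕP.+-suc i f) lt) bq

scan-cong : ∀ (b b′ : ℕ → Bool) f i → (∀ j → j < i + f → b j ≡ b′ j) → scan b i f ≡ scan b′ i f
scan-cong b b′ zero i _ = refl
scan-cong b b′ (suc f) i same rewrite same i (subst (i <_) (sym (ℕP.+-suc i f)) (ℕP.m≤m+n (suc i) f)) with b′ i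
... | true = scan-cong b b′ f (suc i) (λ j lt → same j (subst (j <_) (sym (ℕP.+-suc i f)) lt))
... | false = refl

scan-≤ : ∀ (b : ℕ → Bool) f i → scan b i f ≤ i + f
scan-≤ b zero i = ℕP.≤-reflexive (sym (ℕP.+-identityʳ i))
scan-≤ b (suc f) i with b i
... | true = subst (scan b (suc i) f ≤_) (sym (ℕP.+-suc i f)) (scan-≤ b f (suc i))
... | false = ℕP.m≤m+n i (suc f)

lowestZero : (ℕ → Bool) → ℤ → ℕ → ℕ
lowestZero z m B = scan (sumBit z m) 0 B

lowestZero-≡ : ∀ z m B p q → q < B → sumBit z m q ≡ false → (∀ j → j < p → sumBit z m j ≡ true) → sumBit z m p ≡ false → lowestZero z m B ≡ p
lowestZero-≡ z m B p q qB bq h bp = scan-≡ (sumBit z m) B 0 p z≤n pB (λ j _ lt → h j lt) bp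
  where
  pB : p < B
  pB with p ℕ.<? B
  ... | yes lt = lt
  ... | no nlt with q ℕ.<? p
  ...   | yes qp = ⊥-elim (true≢false (trans (sym (h q qp)) bq))
  ...   | no nqp = ⊥-elim (nlt (ℕP.≤-<-trans (ℕP.≮⇒≥ nqp) qB))

bitAfterLowestZero : (ℕ → Bool) → ℤ → ℕ → Bool
bitAfterLowestZero z m B = sumBit z m (suc (lowestZero z m B))

bitAfterLowestZero-cong : ∀ z z' m m' B B' q q' → (∀ i → sumBit z m i ≡ sumBit z' m' i) → q < B → sumBit z m q ≡ false → q' < B' → sumBit z' m' q' ≡ false →
  bitAfterLowestZero z m B ≡ bitAfterLowestZero z' m' B'
bitAfterLowestZero-cong z z' m m' B B' q q' hb qB bq qB' bq' = trans (cong (λ p → sumBit z m (suc p)) fzeq) (hb (suc p))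
  where
  p = lowestZero z' m' B'
  fzeq : lowestZero z m B ≡ p
  fzeq = lowestZero-≡ z m B p q qB bq (λ j lt → trans (hb j) (scan-least (sumBit z' m') B' 0 j z≤n lt))
           (trans (hb p) (scan-false (sumBit z' m') B' 0 q' z≤n qB' bq'))

-- x₀ 0 1 x₁ 0 1 …: when a small integer is added, the carry is absorbed by a 0 guard
-- (sumBit-no-carry), and a guard also bounds the lowest zero (sumBit-guard).
guarded : (ℕ → Bool) → ℕ → Bool
guarded x 0 = x 0
guarded x 1 = false
guarded x 2 = true
guarded x (suc (suc (suc i))) = guarded (λ n → x (suc n)) i

guarded-data : ∀ x n → guarded x (n * 3) ≡ x n
guarded-data x zero = refl
guarded-data x (suc n) = guarded-data (λ n → x (suc n)) n

guarded-0 : ∀ x n → guarded x (suc (n * 3)) ≡ false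
guarded-0 x zero = refl
guarded-0 x (suc n) = guarded-0 (λ n → x (suc n)) n

guarded-1 : ∀ x n → guarded x (suc (suc (n * 3))) ≡ true
guarded-1 x zero = refl
guarded-1 x (suc n) = guarded-1 (λ n → x (suc n)) n

guarded-cong : ∀ x y → (∀ n → x n ≡ y n) → ∀ i → guarded x i ≡ guarded y i
guarded-cong x y h 0 = h 0
guarded-cong x y h 1 = refl
guarded-cong x y h 2 = refl
guarded-cong x y h (suc (suc (suc i))) = guarded-cong (λ n → x (suc n)) (λ n → y (suc n)) (λ n → h (suc n)) i

guarded-tail : ∀ N x y → (∀ n → N ≤ n → x n ≡ y n) → ∀ i → N * 3 ≤ i → guarded x i ≡ guarded y i
guarded-tail zero x y h i _ = guarded-cong x y (λ n → h n z≤n) i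
guarded-tail (suc N) x y h (suc (suc (suc i))) (s≤s (s≤s (s≤s le))) = guarded-tail N (λ n → x (suc n)) (λ n → y (suc n)) (λ n le' → h (suc n) (s≤s le')) i le

guarded-initial : ∀ K x y → (∀ n → n < K → x n ≡ y n) → ∀ i → i < K * 3 → guarded x i ≡ guarded y i
guarded-initial (suc K) x y h 0 _ = h 0 (s≤s z≤n)
guarded-initial (suc K) x y h 1 _ = refl
guarded-initial (suc K) x y h 2 _ = refl
guarded-initial (suc K) x y h (suc (suc (suc i))) (s≤s (s≤s (s≤s lt))) = guarded-initial K (λ n → x (suc n)) (λ n → y (suc n)) (λ n lt' → h (suc n) (s≤s lt')) i lt

guarded-offset-range : ∀ x s m → ∣ m ∣ ≤ s → Σ ℕ λ u → (+ prefix (guarded x) (suc s * 3) ℤ.+ m ≡ + u) × (u < 2 ^ (suc s * 3))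
guarded-offset-range x s m le = go m le
  where
  K = s * 3
  z = guarded x
  P = 2 ^ suc K
  a0 = prefix z (suc K)
  a0< : a0 < P
  a0< = prefix<2^ z (suc K)
  A = prefix z (suc s * 3)
  eA : A ≡ a0 + 2 * P
  eA rewrite guarded-0 x s | guarded-1 x s = algebra a0 P
    where
    algebra : ∀ a P → a + 0 * P + 1 * (2 * P) ≡ a + 2 * P
    algebra = ℕ-solve
  s<P : s < P
  s<P = ℕP.<-≤-trans (n<2^n s) (ℕP.^-monoʳ-≤ 2 (ℕP.≤-trans (ℕP.m≤m*n s 3) (ℕP.n≤1+n K)))
  top : 2 ^ (suc s * 3) ≡ 4 * P
  top = algebra P
    where
    algebra : ∀ P → 2 * (2 * P) ≡ 4 * P
    algebra = ℕ-solve
  go : ∀ m → ∣ m ∣ ≤ s → Σ ℕ λ u → (+ A ℤ.+ m ≡ + u) × (u < 2 ^ (suc s * 3))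
  go (+ t) le = A + t , sym (ℤP.pos-+ A t) , subst (A + t <_) (sym top) lt
    where
    lt : A + t < 4 * P
    lt = subst (λ y → y + t < 4 * P) (sym eA) (ℕP.<-≤-trans (ℕP.+-mono-<-≤ (ℕP.+-monoˡ-< (2 * P) a0<) (ℕP.<⇒≤ (ℕP.≤-<-trans le s<P)))
           (ℕP.≤-reflexive (algebra P)))
      where
      algebra : ∀ P → P + 2 * P + P ≡ 4 * P
      algebra = ℕ-solve
  go (-[1+ t ]) le = A ∸ suc t , ℤP.⊖-≥ tA , subst (A ∸ suc t <_) (sym top) lt
    where
    tA : suc t ≤ A
    tA = subst (suc t ≤_) (sym eA) (ℕP.≤-trans (ℕP.<⇒≤ (ℕP.≤-<-trans le s<P)) (ℕP.≤-trans (ℕP.m≤n*m P 2) (ℕP.m≤n+m (2 * P) a0)))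
    lt : A ∸ suc t < 4 * P
    lt = ℕP.≤-<-trans (ℕP.m∸n≤m A (suc t)) (subst (_< 4 * P) (sym eA)
           (ℕP.<-≤-trans (ℕP.+-monoˡ-< (2 * P) a0<) (ℕP.≤-trans (ℕP.m≤m+n (P + 2 * P) P) (ℕP.≤-reflexive (algebra P)))))
      where
      algebra : ∀ P → P + 2 * P + P ≡ 4 * P
      algebra = ℕ-solve

sumBit-guard : ∀ x m → sumBit (guarded x) m (suc (suc ∣ m ∣ * 3)) ≡ false
sumBit-guard x m with guarded-offset-range x ∣ m ∣ m ℕP.≤-refl
... | u , eu , ult = trans (sumBit-no-carry (guarded x) m (suc ∣ m ∣ * 3) u eu ult (suc (suc ∣ m ∣ * 3)) (ℕP.n≤1+n _)) (guarded-0 x (suc ∣ m ∣))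

searchBound : ℤ → ℕ
searchBound m = ∣ m ∣ * 3 + 5

word : (ℕ → Bool) → ℤ → Bool
word x m = bitAfterLowestZero (guarded x) m (searchBound m)

guard<searchBound : ∀ m → suc (suc ∣ m ∣ * 3) < searchBound m
guard<searchBound m = ℕP.≤-reflexive (ℕP.+-comm 5 (∣ m ∣ * 3))

word-determined : ∀ m x y → (∀ n → n < searchBound m + 2 → x n ≡ y n) → word x m ≡ word y m
word-determined m x y same =
  trans (cong (λ p → sumBit X m (suc p)) lowestZero≡)
        (sumBit-cong X Y m (suc p) (λ j lt → same-guarded j (ℕP.<-≤-trans lt
          (ℕP.≤-trans (s≤s (s≤s (scan-≤ (sumBit Y m) (searchBound m) 0))) (ℕP.≤-reflexive (ℕP.+-comm 2 B))))))
  where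
  X = guarded x
  Y = guarded y
  B = searchBound m
  p = lowestZero Y m B
  same-guarded : ∀ j → j < B + 2 → X j ≡ Y j
  same-guarded j lt = guarded-initial (B + 2) x y same j (ℕP.<-≤-trans lt (ℕP.m≤m*n (B + 2) 3))
  lowestZero≡ : lowestZero X m B ≡ p
  lowestZero≡ = scan-cong (sumBit X m) (sumBit Y m) B 0
    (λ j lt → sumBit-cong X Y m j (λ j′ lt′ → same-guarded j′ (ℕP.<-≤-trans lt′ (ℕP.≤-trans lt (ℕP.m≤m+n B 2)))))

-- If x and y agree from N on, then guarded y = guarded x + k for the integer k below.
module ShiftFromE₀ (x y : ℕ → Bool) (N : ℕ) (hxy : ∀ n → N ≤ n → x n ≡ y n) where
  X = guarded x
  Y = guarded y
  K = N * 3

  k : ℤ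
  k = + prefix Y K ℤ.- + prefix X K

  tail-bits : ∀ i → K ≤ i → X i ≡ Y i
  tail-bits = guarded-tail N x y hxy

  prefix-offset : ∀ d → + prefix Y (K + d) ≡ + prefix X (K + d) ℤ.+ k
  prefix-offset zero rewrite ℕP.+-identityʳ K = algebra (+ prefix Y K) (+ prefix X K)
    where
    algebra : ∀ a b → a ≡ b ℤ.+ (a ℤ.- b)
    algebra = solve-∀
  prefix-offset (suc d) rewrite ℕP.+-suc K d =
    trans (ℤP.pos-+ (prefix Y (K + d)) (bitValue (Y (K + d)) * 2 ^ (K + d)))
      (trans (cong (λ t → t ℤ.+ + (bitValue (Y (K + d)) * 2 ^ (K + d))) (prefix-offset d))
        (trans (algebra (+ prefix X (K + d)) k (+ (bitValue (Y (K + d)) * 2 ^ (K + d))))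
          (cong (ℤ._+ k) (trans (cong (λ t → + prefix X (K + d) ℤ.+ + (bitValue t * 2 ^ (K + d))) (sym (tail-bits (K + d) (ℕP.m≤m+n K d))))
             (sym (ℤP.pos-+ (prefix X (K + d)) (bitValue (X (K + d)) * 2 ^ (K + d))))))))
    where
    algebra : ∀ a k b → (a ℤ.+ k) ℤ.+ b ≡ (a ℤ.+ b) ℤ.+ k
    algebra = solve-∀

  agree : ∀ J → Congruent (2 ^ J) (+ prefix Y J) (+ prefix X J ℤ.+ k)
  agree J with J ℕ.≤? K
  ... | no nle = subst (λ t → Congruent (2 ^ J) (+ prefix Y t) (+ prefix X t ℤ.+ k)) (ℕP.m+[n∸m]≡n (ℕP.<⇒≤ (ℕP.≰⇒> nle)))
                   (subst (λ t → Congruent (2 ^ J) t (+ prefix X (K + (J ∸ K)) ℤ.+ k)) (sym (prefix-offset (J ∸ K))) (Congruent-refl (2 ^ J) _))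
  ... | yes le = Congruent-trans (Congruent-sym (prefix-congruent Y J K le))
                 (Congruent-trans (subst (λ t → Congruent (2 ^ J) t (+ prefix X K ℤ.+ k)) (sym (prefix-offset-K)) (Congruent-refl (2 ^ J) _))
                   (Congruent-+ (prefix-congruent X J K le) (Congruent-refl (2 ^ J) k)))
    where
    prefix-offset-K : + prefix Y K ≡ + prefix X K ℤ.+ k
    prefix-offset-K = subst (λ t → + prefix Y t ≡ + prefix X t ℤ.+ k) (ℕP.+-identityʳ K) (prefix-offset 0)

  sumMod-offset : ∀ m J → sumMod Y m J ≡ sumMod X (m ℤ.+ k) J
  sumMod-offset m J = %ℕ-cong (+ prefix Y J ℤ.+ m) (+ prefix X J ℤ.+ (m ℤ.+ k)) (2 ^ J) {{2^-nonZero J}}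
    (subst (Congruent (2 ^ J) (+ prefix Y J ℤ.+ m)) (algebra (+ prefix X J) k m) (Congruent-+ (agree J) (Congruent-refl (2 ^ J) m)))
    where
    algebra : ∀ a k m → (a ℤ.+ k) ℤ.+ m ≡ a ℤ.+ (m ℤ.+ k)
    algebra = solve-∀

  letters : ∀ m → word y m ≡ word x (m ℤ.+ k)
  letters m = bitAfterLowestZero-cong Y X m (m ℤ.+ k) (searchBound m) (searchBound (m ℤ.+ k)) _ _ (λ i → cong (2 ^ i ≤ᵇ_) (sumMod-offset m (suc i)))
    (guard<searchBound m) (sumBit-guard y m) (guard<searchBound (m ℤ.+ k)) (sumBit-guard x (m ℤ.+ k))

-- Conversely the letters force guarded y ≡ guarded x - k modulo every 2^J, and beyond the
-- position where k can carry, the data bits of x and y coincide.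
module E₀FromShift (x y : ℕ → Bool) (k : ℤ) (hyp : ∀ m → word x m ≡ word y (m ℤ.+ k)) where
  X = guarded x
  Y = guarded y

  Agree : ℕ → Set
  Agree J = Congruent (2 ^ J) (+ prefix Y J) (+ prefix X J ℤ.- k)

  agree-zero : Agree 0
  agree-zero = (+ prefix Y 0 ℤ.- (+ prefix X 0 ℤ.- k)) , algebra (+ prefix Y 0) (+ prefix X 0 ℤ.- k)
    where
    algebra : ∀ a b → a ≡ b ℤ.+ (a ℤ.- b) ℤ.* + 1
    algebra = solve-∀

  -- If the congruence holds modulo 2^e but not 2^(e+1), choose m so that X + m ends in e+1 ones,
  -- a zero and ¬β; then Y + m + k ends in e ones, a zero and β, so the letters at m differ.
  module Contradiction (e : ℕ) (h : ℤ) (eq1 : + prefix Y (suc e) ≡ (+ prefix X (suc e) ℤ.- k) ℤ.+ (1ℤ ℤ.+ h ℤ.* + 2) ℤ.* pow2 e) where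
    J₃ = suc e + 2
    SY = prefix-split Y (suc e) 2
    SX = prefix-split X (suc e) 2
    hY = proj₁ SY
    hX = proj₁ SX
    pos-prefix-split : ∀ Z → (Sp : Σ ℕ λ h → prefix Z (suc e + 2) ≡ prefix Z (suc e) + h * 2 ^ suc e) → + prefix Z J₃ ≡ + prefix Z (suc e) ℤ.+ + proj₁ Sp ℤ.* pow2 (suc e)
    pos-prefix-split Z Sp = trans (cong +_ (proj₂ Sp)) (trans (ℤP.pos-+ (prefix Z (suc e)) (proj₁ Sp * 2 ^ suc e)) (cong (λ t → + prefix Z (suc e) ℤ.+ t) (ℤP.pos-* (proj₁ Sp) (2 ^ suc e))))
    Δ : ℤ
    Δ = h ℤ.+ + hY ℤ.- + hX
    Y-expansion : + prefix Y J₃ ≡ ((+ prefix X J₃ ℤ.- k) ℤ.+ pow2 e) ℤ.+ Δ ℤ.* pow2 (suc e)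
    Y-expansion = trans (pos-prefix-split Y SY) (trans (cong (λ t → t ℤ.+ + hY ℤ.* pow2 (suc e)) eq1)
           (trans (cong (λ t → ((+ prefix X (suc e) ℤ.- k) ℤ.+ (1ℤ ℤ.+ h ℤ.* + 2) ℤ.* pow2 e) ℤ.+ + hY ℤ.* t) (pow2-suc e))
             (trans (algebra (+ prefix X (suc e)) k h (+ hY) (+ hX) (pow2 e))
               (trans (cong (λ Ps → ((+ prefix X (suc e) ℤ.+ + hX ℤ.* Ps) ℤ.- k ℤ.+ pow2 e) ℤ.+ Δ ℤ.* Ps) (sym (pow2-suc e)))
                 (cong (λ t → ((t ℤ.- k) ℤ.+ pow2 e) ℤ.+ Δ ℤ.* pow2 (suc e)) (sym (pos-prefix-split X SX)))))))
      where
      algebra : ∀ A k h HY HX P → ((A ℤ.- k) ℤ.+ (1ℤ ℤ.+ h ℤ.* + 2) ℤ.* P) ℤ.+ HY ℤ.* (+ 2 ℤ.* P) ≡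
             ((A ℤ.+ HX ℤ.* (+ 2 ℤ.* P)) ℤ.- k ℤ.+ P) ℤ.+ (h ℤ.+ HY ℤ.- HX) ℤ.* (+ 2 ℤ.* P)
      algebra = solve-∀
    parity-Δ = parity (Δ ℤ.+ 1ℤ)
    r₀ = proj₁ parity-Δ
    g = Congruent.quotient (proj₂ (proj₂ parity-Δ))
    Δ+1≡ : Δ ℤ.+ 1ℤ ≡ + r₀ ℤ.+ g ℤ.* + 2
    Δ+1≡ = Congruent.equation (proj₂ (proj₂ parity-Δ))
    β-choice = bitValue-onto r₀ (proj₁ (proj₂ parity-Δ))
    β = proj₁ β-choice
    r₀≡β : r₀ ≡ bitValue β
    r₀≡β = proj₂ β-choice
    q = bitValue (not β)
    P = 2 ^ suc e
    target : ℕ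
    target = (P ∸ 1) + P * (2 * q)
    m : ℤ
    m = + target ℤ.- + prefix X J₃
    X+m≡ : + prefix X J₃ ℤ.+ m ≡ + target
    X+m≡ = algebra (+ prefix X J₃) (+ target)
      where
      algebra : ∀ a b → a ℤ.+ (b ℤ.- a) ≡ b
      algebra = solve-∀
    target≡ : + target ≡ (pow2 (suc e) ℤ.- 1ℤ) ℤ.+ pow2 (suc e) ℤ.* (+ 2 ℤ.* + q)
    target≡ = trans (ℤP.pos-+ (P ∸ 1) (P * (2 * q)))
      (cong₂ ℤ._+_ (pos-∸1 P (ℕP.m^n>0 2 (suc e))) (trans (ℤP.pos-* P (2 * q)) (cong (λ t → pow2 (suc e) ℤ.* t) (ℤP.pos-* 2 q))))
    c : ℤ
    c = + bitValue β ℤ.+ (g ℤ.+ + q) ℤ.* + 2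
    Y+m+k≡ : + prefix Y J₃ ℤ.+ (m ℤ.+ k) ≡ (pow2 e ℤ.- 1ℤ) ℤ.+ pow2 (suc e) ℤ.* c
    Y+m+k≡ = trans (cong (λ t → t ℤ.+ (m ℤ.+ k)) Y-expansion)
      (trans (algebra₁ (+ prefix X J₃) k (pow2 e) Δ (pow2 (suc e)) (+ target))
        (trans (cong (λ t → (pow2 e ℤ.+ Δ ℤ.* pow2 (suc e)) ℤ.+ t) target≡)
          (trans (cong (λ t → (pow2 e ℤ.+ Δ ℤ.* t) ℤ.+ ((t ℤ.- 1ℤ) ℤ.+ t ℤ.* (+ 2 ℤ.* + q))) (pow2-suc e))
            (trans (algebra₂ (pow2 e) Δ (+ q))
              (trans (cong (λ t → (pow2 e ℤ.- 1ℤ) ℤ.+ (+ 2 ℤ.* pow2 e) ℤ.* (t ℤ.+ + 2 ℤ.* + q)) Δ+1≡)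
                (trans (cong (λ t → (pow2 e ℤ.- 1ℤ) ℤ.+ (+ 2 ℤ.* pow2 e) ℤ.* ((+ t ℤ.+ g ℤ.* + 2) ℤ.+ + 2 ℤ.* + q)) r₀≡β)
                  (trans (algebra₃ (pow2 e) (+ bitValue β) g (+ q)) (cong (λ t → (pow2 e ℤ.- 1ℤ) ℤ.+ t ℤ.* c) (sym (pow2-suc e))))))))))
      where
      algebra₁ : ∀ A k P D Ps T → (((A ℤ.- k) ℤ.+ P) ℤ.+ D ℤ.* Ps) ℤ.+ ((T ℤ.- A) ℤ.+ k) ≡ (P ℤ.+ D ℤ.* Ps) ℤ.+ T
      algebra₁ = solve-∀
      algebra₂ : ∀ P D q → (P ℤ.+ D ℤ.* (+ 2 ℤ.* P)) ℤ.+ (((+ 2 ℤ.* P) ℤ.- 1ℤ) ℤ.+ (+ 2 ℤ.* P) ℤ.* (+ 2 ℤ.* q)) ≡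
                      (P ℤ.- 1ℤ) ℤ.+ (+ 2 ℤ.* P) ℤ.* ((D ℤ.+ 1ℤ) ℤ.+ + 2 ℤ.* q)
      algebra₂ = solve-∀
      algebra₃ : ∀ P b g q → (P ℤ.- 1ℤ) ℤ.+ (+ 2 ℤ.* P) ℤ.* ((b ℤ.+ g ℤ.* + 2) ℤ.+ + 2 ℤ.* q) ≡ (P ℤ.- 1ℤ) ℤ.+ (+ 2 ℤ.* P) ℤ.* (b ℤ.+ (g ℤ.+ q) ℤ.* + 2)
      algebra₃ = solve-∀

    ≤J : ∀ i → i ≤ suc (suc (suc e)) → i ≤ J₃
    ≤J i le = ℕP.≤-trans le (ℕP.≤-reflexive (sym (trans (ℕP.+-comm (suc e) 2) refl)))

    X+m-ones : ∀ j → j < suc e → sumBit X m j ≡ true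
    X+m-ones = sumBit-ones X m J₃ (suc e) (+ 2 ℤ.* + q) (≤J (suc e) (ℕP.m≤n+m (suc e) 2)) (trans X+m≡ target≡)
    X+m-zero : sumBit X m (suc e) ≡ false
    X+m-zero = trans (sumBit-from-congruence X m J₃ (suc e) (P ∸ 1) (≤J (suc (suc e)) (ℕP.m≤n+m (suc (suc e)) 1)) (ℕP.<-≤-trans (∸1< P (ℕP.m^n>0 2 (suc e))) (ℕP.m≤n*m P 2))
           (((+ q) , (trans X+m≡ (trans (ℤP.pos-+ (P ∸ 1) (P * (2 * q))) (cong (λ t → + (P ∸ 1) ℤ.+ t) (trans (cong +_ (algebra P q)) (ℤP.pos-* q (2 * P)))))))))
           (≤ᵇ-false (∸1< P (ℕP.m^n>0 2 (suc e))))
      where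
      algebra : ∀ P q → P * (2 * q) ≡ q * (2 * P)
      algebra = ℕ-solve
    target≡′ : target ≡ (P ∸ 1) + bitValue (not β) * (2 * P)
    target≡′ = cong (λ t → (P ∸ 1) + t) (algebra P q)
      where
      algebra : ∀ P q → P * (2 * q) ≡ q * (2 * P)
      algebra = ℕ-solve
    P∸1<2P : P ∸ 1 < 2 * P
    P∸1<2P = ℕP.<-≤-trans (∸1< P (ℕP.m^n>0 2 (suc e))) (ℕP.m≤n*m P 2)
    X+m-next : sumBit X m (suc (suc e)) ≡ not β
    X+m-next = trans (sumBit-from-congruence X m J₃ (suc (suc e)) target (≤J _ ℕP.≤-refl) (subst (_< 2 ^ suc (suc (suc e))) (sym target≡′) (bitValue-bound (P ∸ 1) (2 * P) (not β) P∸1<2P))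
            (subst (Congruent (2 ^ suc (suc (suc e))) (+ prefix X J₃ ℤ.+ m)) X+m≡ (Congruent-refl _ _)))
            (trans (cong (2 ^ suc (suc e) ≤ᵇ_) target≡′) (bit-of-value (2 * P) (P ∸ 1) (not β) P∸1<2P))

    Y+m+k-ones : ∀ j → j < e → sumBit Y (m ℤ.+ k) j ≡ true
    Y+m+k-ones = sumBit-ones Y (m ℤ.+ k) J₃ e (+ 2 ℤ.* c) (≤J e (ℕP.m≤n+m e 3))
            (trans Y+m+k≡ (cong (λ t → (pow2 e ℤ.- 1ℤ) ℤ.+ t) (trans (cong (ℤ._* c) (pow2-suc e)) (algebra (pow2 e) c))))
      where
      algebra : ∀ P c → (+ 2 ℤ.* P) ℤ.* c ≡ P ℤ.* (+ 2 ℤ.* c)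
      algebra = solve-∀
    Y+m+k-zero : sumBit Y (m ℤ.+ k) e ≡ false
    Y+m+k-zero = trans (sumBit-from-congruence Y (m ℤ.+ k) J₃ e (2 ^ e ∸ 1) (≤J (suc e) (ℕP.m≤n+m (suc e) 2))
                 (ℕP.<-≤-trans (∸1< (2 ^ e) (ℕP.m^n>0 2 e)) (ℕP.m≤n*m (2 ^ e) 2))
                 ((c , (trans Y+m+k≡ (trans (cong (λ t → t ℤ.+ pow2 (suc e) ℤ.* c) (sym (pos-∸1 (2 ^ e) (ℕP.m^n>0 2 e)))) (cong (λ t → + (2 ^ e ∸ 1) ℤ.+ t) (ℤP.*-comm (pow2 (suc e)) c)))))))
               (≤ᵇ-false (∸1< (2 ^ e) (ℕP.m^n>0 2 e)))
    rY = (2 ^ e ∸ 1) + bitValue β * 2 ^ suc e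
    2^e∸1<2^suc : 2 ^ e ∸ 1 < 2 ^ suc e
    2^e∸1<2^suc = ℕP.<-≤-trans (∸1< (2 ^ e) (ℕP.m^n>0 2 e)) (ℕP.m≤n*m (2 ^ e) 2)
    Y+m+k-next : sumBit Y (m ℤ.+ k) (suc e) ≡ β
    Y+m+k-next = trans (sumBit-from-congruence Y (m ℤ.+ k) J₃ (suc e) rY (≤J (suc (suc e)) (ℕP.m≤n+m (suc (suc e)) 1)) (bitValue-bound (2 ^ e ∸ 1) (2 ^ suc e) β 2^e∸1<2^suc)
                 (((g ℤ.+ + q) , (trans Y+m+k≡ (trans (algebra (pow2 e ℤ.- 1ℤ) (pow2 (suc e)) (+ bitValue β) (g ℤ.+ + q))
                     (cong₂ (λ t u → t ℤ.+ (g ℤ.+ + q) ℤ.* u)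
                       (sym (trans (ℤP.pos-+ (2 ^ e ∸ 1) (bitValue β * 2 ^ suc e)) (cong₂ ℤ._+_ (pos-∸1 (2 ^ e) (ℕP.m^n>0 2 e)) (ℤP.pos-* (bitValue β) (2 ^ suc e)))))
                       (sym (pow2-suc (suc e)))))))))
               (bit-of-value (2 ^ suc e) (2 ^ e ∸ 1) β 2^e∸1<2^suc)
      where
      algebra : ∀ A Ps b G → A ℤ.+ Ps ℤ.* (b ℤ.+ G ℤ.* + 2) ≡ (A ℤ.+ b ℤ.* Ps) ℤ.+ G ℤ.* (+ 2 ℤ.* Ps)
      algebra = solve-∀

    lowestZero-X : lowestZero X m (searchBound m) ≡ suc e
    lowestZero-X = lowestZero-≡ X m (searchBound m) (suc e) _ (guard<searchBound m) (sumBit-guard x m) X+m-ones X+m-zero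
    lowestZero-Y : lowestZero Y (m ℤ.+ k) (searchBound (m ℤ.+ k)) ≡ e
    lowestZero-Y = lowestZero-≡ Y (m ℤ.+ k) (searchBound (m ℤ.+ k)) e _ (guard<searchBound (m ℤ.+ k)) (sumBit-guard y (m ℤ.+ k)) Y+m+k-ones Y+m+k-zero

    absurd : ⊥
    absurd = not≢ β (trans (sym (trans (cong (λ p → sumBit X m (suc p)) lowestZero-X) X+m-next)) (trans (hyp m) (trans (cong (λ p → sumBit Y (m ℤ.+ k) (suc p)) lowestZero-Y) Y+m+k-next)))
      where
      not≢ : ∀ b → not b ≢ b
      not≢ true ()
      not≢ false ()

  agree-suc : ∀ e → Agree e → Agree (suc e)
  agree-suc e (t , eq) = by-parity (proj₁ parity-carry) (proj₁ (proj₂ parity-carry)) (Congruent.equation (proj₂ (proj₂ parity-carry)))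
    where
    carry = t ℤ.+ + bitValue (Y e) ℤ.- + bitValue (X e)
    parity-carry = parity carry
    w = Congruent.quotient (proj₂ (proj₂ parity-carry))
    Y≡X-k+carry : + prefix Y (suc e) ≡ (+ prefix X (suc e) ℤ.- k) ℤ.+ carry ℤ.* pow2 e
    Y≡X-k+carry = trans (ℤP.pos-+ (prefix Y e) (bitValue (Y e) * 2 ^ e))
          (trans (cong₂ ℤ._+_ eq (ℤP.pos-* (bitValue (Y e)) (2 ^ e)))
            (trans (algebra (+ prefix X e) k t (+ bitValue (Y e)) (+ bitValue (X e)) (pow2 e))
              (cong (λ u → (u ℤ.- k) ℤ.+ carry ℤ.* pow2 e) (sym (trans (ℤP.pos-+ (prefix X e) (bitValue (X e) * 2 ^ e)) (cong (λ u → + prefix X e ℤ.+ u) (ℤP.pos-* (bitValue (X e)) (2 ^ e))))))))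
      where
      algebra : ∀ A k t BY BX P → ((A ℤ.- k) ℤ.+ t ℤ.* P) ℤ.+ BY ℤ.* P ≡ ((A ℤ.+ BX ℤ.* P) ℤ.- k) ℤ.+ (t ℤ.+ BY ℤ.- BX) ℤ.* P
      algebra = solve-∀
    by-parity : ∀ r → r < 2 → carry ≡ + r ℤ.+ w ℤ.* + 2 → Agree (suc e)
    by-parity zero _ carry≡ = (w , (trans Y≡X-k+carry (trans (cong (λ u → (+ prefix X (suc e) ℤ.- k) ℤ.+ u ℤ.* pow2 e) carry≡)
                      (trans (algebra (+ prefix X (suc e) ℤ.- k) w (pow2 e)) (cong (λ u → (+ prefix X (suc e) ℤ.- k) ℤ.+ w ℤ.* u) (sym (pow2-suc e)))))))
      where
      algebra : ∀ A w P → A ℤ.+ (+ 0 ℤ.+ w ℤ.* + 2) ℤ.* P ≡ A ℤ.+ w ℤ.* (+ 2 ℤ.* P)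
      algebra = solve-∀
    by-parity (suc zero) _ carry≡ = ⊥-elim (Contradiction.absurd e w (trans Y≡X-k+carry (cong (λ u → (+ prefix X (suc e) ℤ.- k) ℤ.+ u ℤ.* pow2 e) carry≡)))
    by-parity (suc (suc r)) (s≤s (s≤s ())) carry≡

  agree : ∀ J₃ → Agree J₃
  agree zero = agree-zero
  agree (suc J₃) = agree-suc J₃ (agree J₃)

  tails-agree : ∀ n → suc ∣ k ∣ ≤ n → x n ≡ y n
  tails-agree (suc s) (s≤s le) with guarded-offset-range x s (ℤ.- k) (subst (_≤ s) (sym (ℤP.∣-i∣≡∣i∣ k)) le)
  ... | u , eu , ult = trans (sym (guarded-data x (suc s))) (trans (sym nc) (trans (cong (2 ^ i ≤ᵇ_) Rv) (trans (prefix-bit Y i) (guarded-data y (suc s)))))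
    where
    i = suc s * 3
    nc : sumBit X (ℤ.- k) i ≡ X i
    nc = sumBit-no-carry X (ℤ.- k) i u eu ult i ℕP.≤-refl
    Rv : sumMod X (ℤ.- k) (suc i) ≡ prefix Y (suc i)
    Rv = trans (%ℕ-cong _ _ (2 ^ suc i) {{2^-nonZero (suc i)}} (Congruent-sym (agree (suc i))))
               (%ℕ-small (prefix Y (suc i)) (2 ^ suc i) {{2^-nonZero (suc i)}} (prefix<2^ Y (suc i)))

-- Borel codes

-- Intersections are complements of unions, so eliminating them needs stability under double negation.
choose : BorelCode → BorelCode → ℕ → BorelCode
choose A B zero = A
choose A B (suc _) = B

_∪_ _∩_ : BorelCode → BorelCode → BorelCode
A ∪ B = union (choose A B)
A ∩ B = compl (union (λ i → compl (choose A B i)))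

Stable : BorelCode → Set
Stable c = ∀ x → ¬ ¬ ⟦ c ⟧ x → ⟦ c ⟧ x

∩-intro : ∀ A B {x} → ⟦ A ⟧ x → ⟦ B ⟧ x → ⟦ A ∩ B ⟧ x
∩-intro A B a b (zero , ¬a) = ¬a a
∩-intro A B a b (suc _ , ¬b) = ¬b b

∩-elim : ∀ {A B} → Stable A → Stable B → ∀ {x} → ⟦ A ∩ B ⟧ x → ⟦ A ⟧ x × ⟦ B ⟧ x
∩-elim stable-A stable-B {x} both = stable-A x (λ ¬a → both (zero , ¬a)) , stable-B x (λ ¬b → both (suc zero , ¬b))

basic-stable : ∀ n b → Stable (basic n b)
basic-stable n b x ¬¬eq with x n ≟ᵇ b
... | yes eq = eq
... | no ne = ⊥-elim (¬¬eq ne)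

∅ : BorelCode
∅ = basic 0 true ∩ basic 0 false

∅-empty : ∀ x → ¬ ⟦ ∅ ⟧ x
∅-empty x in-∅ with ∩-elim (basic-stable 0 true) (basic-stable 0 false) in-∅
... | x0≡true , x0≡false with trans (sym x0≡true) x0≡false
... | ()

decided-stable : ∀ (g : Cantor → Bool) c → (∀ x → (g x ≡ true) ⇔ ⟦ c ⟧ x) → Stable c
decided-stable g c equiv x ¬¬c with g x ≟ᵇ true
... | yes eq = Equivalence.to (equiv x) eq
... | no ne = ⊥-elim (¬¬c λ in-c → ne (Equivalence.from (equiv x) in-c))

DeterminedBelow : ℕ → (Cantor → Bool) → Set
DeterminedBelow K g = ∀ x y → (∀ n → n < K → x n ≡ y n) → g x ≡ g y

_[_≔_] : Cantor → ℕ → Bool → Cantor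
(x [ K ≔ b ]) n with n ℕ.≟ K
... | yes _ = b
... | no _ = x n

-- Split on the last relevant coordinate K: g x holds iff x K = b and g (x [ K ≔ b ]) holds for some b.
determined⇒borel : ∀ K (g : Cantor → Bool) → DeterminedBelow K g → IsBorelSet (λ x → g x ≡ true)
determined⇒borel zero g determined with g (λ _ → false) in eq
... | true = compl ∅ , λ x → mk⇔ (λ _ → ∅-empty x) (λ _ → trans (determined x _ (λ _ ())) eq)
... | false = ∅ , λ x → mk⇔ (λ g≡true → ⊥-elim (true≢false (trans (sym g≡true) (trans (determined x _ (λ _ ())) eq)))) (λ in-∅ → ⊥-elim (∅-empty x in-∅))
determined⇒borel (suc K) g determined = (basic K true ∩ code true) ∪ (basic K false ∩ code false) , semantics
  where
  g[_] : Bool → Cantor → Bool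
  g[ b ] x = g (x [ K ≔ b ])
  g[b]-determined : ∀ b → DeterminedBelow K g[ b ]
  g[b]-determined b x y same = determined _ _ same′
    where
    same′ : ∀ n → n < suc K → (x [ K ≔ b ]) n ≡ (y [ K ≔ b ]) n
    same′ n lt with n ℕ.≟ K
    ... | yes _ = refl
    ... | no n≢K = same n (ℕP.≤∧≢⇒< (ℕP.≤-pred lt) n≢K)
  code : Bool → BorelCode
  code b = proj₁ (determined⇒borel K g[ b ] (g[b]-determined b))
  code-correct : ∀ b x → (g[ b ] x ≡ true) ⇔ ⟦ code b ⟧ x
  code-correct b = proj₂ (determined⇒borel K g[ b ] (g[b]-determined b))
  g[xK] : ∀ x b → x K ≡ b → g[ b ] x ≡ g x
  g[xK] x b xK≡b = determined _ x same
    where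
    same : ∀ n → n < suc K → (x [ K ≔ b ]) n ≡ x n
    same n _ with n ℕ.≟ K
    ... | yes refl = sym xK≡b
    ... | no _ = refl
  semantics : ∀ x → (g x ≡ true) ⇔ ⟦ (basic K true ∩ code true) ∪ (basic K false ∩ code false) ⟧ x
  semantics x = mk⇔ to from
    where
    to : g x ≡ true → ⟦ (basic K true ∩ code true) ∪ (basic K false ∩ code false) ⟧ x
    to g≡true with x K in xK
    ... | true = zero , ∩-intro (basic K true) (code true) xK (Equivalence.to (code-correct true x) (trans (g[xK] x true xK) g≡true))
    ... | false = suc zero , ∩-intro (basic K false) (code false) xK (Equivalence.to (code-correct false x) (trans (g[xK] x false xK) g≡true))
    from-branch : ∀ b → ⟦ basic K b ∩ code b ⟧ x → g x ≡ true
    from-branch b in-branch with ∩-elim (basic-stable K b) (decided-stable g[ b ] (code b) (code-correct b)) in-branch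
    ... | xK , in-code = trans (sym (g[xK] x b xK)) (Equivalence.from (code-correct b x) in-code)
    from : ⟦ (basic K true ∩ code true) ∪ (basic K false ∩ code false) ⟧ x → g x ≡ true
    from (zero , in-branch) = from-branch true in-branch
    from (suc _ , in-branch) = from-branch false in-branch

tournament-determined : ∀ a b → Σ ℕ λ K → DeterminedBelow K (λ x → tournament (word x) a b)
tournament-determined a b with a ℕ.≟ b
... | yes _ = 0 , λ _ _ _ → refl
... | no a≢b = let L = proj₁ (highestDiff a≢b) in
  searchBound L + 2 , λ x y same → cong (λ v → circulant v (digitAt a L) (digitAt b L)) (word-determined L x y same)

tournament-borel : IsBorelFun (λ x → tournament (word x))
tournament-borel a b = let K , determined = tournament-determined a b in determined⇒borel K _ determined

E₀⇒isomorphic : ∀ x y → E₀ x y → tournament (word x) ≅ tournament (word y)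
E₀⇒isomorphic x y (N , agree) = shifted-isomorphic (word x) (word y) k λ L →
  trans (letters (L ℤ.- k)) (cong (word x) (-+-cancel L k))
  where
  open ShiftFromE₀ x y N agree

isomorphic⇒E₀ : ∀ x y → tournament (word x) ≅ tournament (word y) → E₀ x y
isomorphic⇒E₀ x y (σ , hom) = suc ∣ shift ∣ , E₀FromShift.tails-agree x y shift letters
  where open Isomorphism σ hom

theorem4p2 : Σ (Cantor → BinRel) λ f →
    IsBorelFun f ×
    (∀ x → IsTournament (f x) × IsVertexTransitive (f x)) ×
    (∀ x y → E₀ x y ⇔ (f x ≅ f y))
theorem4p2 =
  (λ x → tournament (word x)) ,
  tournament-borel ,
  (λ x → tournament-isTournament (word x) , tournament-vertexTransitive (word x)) ,
  λ x y → mk⇔ (E₀⇒isomorphic x y) (isomorphic⇒E₀ x y)
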